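{- Let $\beta\ge3$, let $\alpha\in\{2\beta,2\beta+1\}$, $q=2^\alpha$, and let $\chi$ be a Dirichlet character modulo $q$ induced from a character modulo $2^\beta$. Let $u$ be an odd integer and put $\omega=\exp(4\pi iu/q)$, $\sqrt i=e^{\pi i/4}$. (1) If $\alpha=2\beta$, then $$S_\chi(u,u;q)=2^\beta\Big(\omega\big(\chi(1)+i^u\chi(1+2^{\beta-1})\big)+\overline\omega\big(\chi(-1)-i^u\chi(-1+2^{\beta-1})\big)\Big).$$ (2) If $\alpha=2\beta+1$, then $$S_\chi(u,u;q)=2^\beta\Big(2\omega\, i^u\sqrt i^{\,ut}\chi(1+2^{\beta-1})+\overline\omega\,\chi(-1+2^{\beta-1})\big(\sqrt i^{\,ut}+i^{ -u}\sqrt i^{\,us}\big)\Big),$$ where $s=5,\ t=3$ if $\beta=3$, and $s=1,\ t=-1$ otherwise.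
   Context: For a positive integer $k$, integers $a,b$ and a Dirichlet character $\chi$ modulo $k$, $S_\chi(a,b;k)=\sum_{0\le h<k,\ \gcd(h,k)=1}\chi(h)\exp\big(\frac{2\pi i}{k}(ah+b\overline h)\big)$, where $\overline h$ is an inverse of $h$ modulo $k$; $\overline\omega$ denotes complex conjugation. -}

module Defs where

open import Data.Nat as ℕ using (ℕ; zero; suc; _∸_; _^_)
open import Data.Nat.GCD using (gcd)
open import Data.Nat.Divisibility using (_∣?_)
open import Data.Integer as ℤ using (ℤ; +_; -[1+_]; ∣_∣)
open import Data.Vec using (Vec; []; _∷_; _∷ʳ_; init; last; replicate; zipWith; map; toList)
open import Data.List using (List) renaming ([] to []ᴸ; _∷_ to _∷ᴸ_)
open import Data.Bool using (Bool; if_then_else_; _∧_)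
open import Data.Product using (_×_; Σ)
open import Relation.Nullary using (¬_)
open import Relation.Nullary.Decidable using (⌊_⌋)
open import Relation.Binary.PropositionalEquality using (_≡_; _≢_)
open import Function using (_∘_)

-- The cyclotomic ring ℤ[ζ_q], q = 2^α, realised as ℤ[x]/(x^(q/2) + 1).
-- An element  (a₀ , … , a_{n-1})  (n = 2^(α-1)) stands for the complex
-- number  Σ aᵢ ζ^i  with  ζ = exp(2πi/q).  Since x^(q/2)+1 is the q-th
-- cyclotomic polynomial (α ≥ 1), this is an exact model of ℤ[ζ_q] ⊂ ℂ,
-- and equality of complex numbers is equality of coefficient vectors.

half : ℕ → ℕ
half α = 2 ^ (α ∸ 1)

Cyc : ℕ → Set
Cyc α = Vec ℤ (half α)

0c : ∀ {n} → Vec ℤ n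
0c = replicate _ (+ 0)

1c : ∀ {n} → Vec ℤ n
1c {zero}  = []
1c {suc m} = + 1 ∷ replicate _ (+ 0)

_⊕_ : ∀ {n} → Vec ℤ n → Vec ℤ n → Vec ℤ n
_⊕_ = zipWith ℤ._+_

⊖_ : ∀ {n} → Vec ℤ n → Vec ℤ n
⊖ v = map (λ x → ℤ.- x) v

_·_ : ∀ {n} → ℤ → Vec ℤ n → Vec ℤ n
c · v = map (c ℤ.*_) v

mulζ : ∀ {n} → Vec ℤ n → Vec ℤ n
mulζ []       = []
mulζ (x ∷ xs) = ℤ.- last (x ∷ xs) ∷ init (x ∷ xs)

mulζ⁻¹ : ∀ {n} → Vec ℤ n → Vec ℤ n
mulζ⁻¹ []       = []
mulζ⁻¹ (x ∷ xs) = xs ∷ʳ (ℤ.- x)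

iter : ∀ {A : Set} → ℕ → (A → A) → A → A
iter zero    f a = a
iter (suc k) f a = f (iter k f a)

horner : ∀ {n} → List ℤ → Vec ℤ n → Vec ℤ n
horner []ᴸ       b = 0c
horner (c ∷ᴸ cs) b = (c · b) ⊕ mulζ (horner cs b)

infixl 7 _⊛_
infixl 6 _⊕_
_⊛_ : ∀ {n} → Vec ℤ n → Vec ℤ n → Vec ℤ n
a ⊛ b = horner (toList a) b

ζ^ : ∀ {n} → ℤ → Vec ℤ n
ζ^ (+ k)     = iter k mulζ 1c
ζ^ -[1+ k ]  = iter (suc k) mulζ⁻¹ 1c

conjAux : ∀ {n} → ℕ → List ℤ → Vec ℤ n
conjAux i []ᴸ       = 0c
conjAux i (c ∷ᴸ cs) = (c · ζ^ (ℤ.- (+ i))) ⊕ conjAux (suc i) cs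

conj : ∀ {n} → Vec ℤ n → Vec ℤ n
conj a = conjAux 0 (toList a)

-- Dirichlet characters modulo m with values in ℤ[ζ_q]
-- (every complex Dirichlet character modulo 2^β, β ≤ α, takes values in
-- the 2^(β-2)-th roots of unity, which lie in ℤ[ζ_q]).

record IsDirichletChar {n : ℕ} (m : ℕ) (χ : ℤ → Vec ℤ n) : Set where
  field
    mult     : ∀ a b → χ (a ℤ.* b) ≡ χ a ⊛ χ b
    periodic : ∀ a → χ (a ℤ.+ + m) ≡ χ a
    one      : χ (+ 1) ≡ 1c
    vanish   : ∀ a → gcd ∣ a ∣ m ≢ 1 → χ a ≡ 0c
    nonvan   : ∀ a → gcd ∣ a ∣ m ≡ 1 → χ a ≢ 0c

InducedFrom : ∀ {n} (q d : ℕ) (χ : ℤ → Vec ℤ n) → Set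
InducedFrom {n} q d χ =
  Σ (ℤ → Vec ℤ n) λ χ′ → IsDirichletChar d χ′ × (∀ h → gcd ∣ h ∣ q ≡ 1 → χ h ≡ χ′ h)

sumTo : ∀ {n} → ℕ → (ℕ → Vec ℤ n) → Vec ℤ n
sumTo zero    f = 0c
sumTo (suc k) f = sumTo k f ⊕ f k

isInvPair : ℕ → ℕ → ℕ → Bool
isInvPair q h g = ⌊ gcd h q ℕ.≟ 1 ⌋ ∧ ⌊ q ∣? ∣ (+ h ℤ.* + g) ℤ.- + 1 ∣ ⌋

S : (α : ℕ) → (ℤ → Cyc α) → ℤ → ℤ → Cyc α
S α χ a b =
  sumTo (2 ^ α) λ h → sumTo (2 ^ α) λ g →
    if isInvPair (2 ^ α) h g
      then χ (+ h) ⊛ ζ^ (a ℤ.* + h ℤ.+ b ℤ.* + g)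
      else 0c

-- integer powers of a root of unity x (x⁻¹ = conj x for |x| = 1)
_^ᶻ_ : ∀ {n} → Vec ℤ n → ℤ → Vec ℤ n
x ^ᶻ (+ k)     = iter k (x ⊛_) 1c
x ^ᶻ -[1+ k ]  = iter (suc k) (conj x ⊛_) 1c

-- i = e^{πi/2} = ζ^{q/4},  √i = e^{πi/4} = ζ^{q/8}   (q = 2^α)
iC : (α : ℕ) → Cyc α
iC α = ζ^ (+ (2 ^ (α ∸ 2)))

sqrtiC : (α : ℕ) → Cyc α
sqrtiC α = ζ^ (+ (2 ^ (α ∸ 3)))

-- ω = exp(4πiu/q) = ζ^{2u}
ωC : (α : ℕ) → ℤ → Cyc α
ωC α u = ζ^ (+ 2 ℤ.* u)

sC : ℕ → ℤ
sC 3 = + 5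
sC _ = + 1

tC : ℕ → ℤ
tC 3 = + 3
tC _ = ℤ.- (+ 1)

OddZ : ℤ → Set
OddZ u = Σ ℤ λ k → u ≡ + 1 ℤ.+ + 2 ℤ.* k

{-# OPTIONS --safe #-}
-- Split h = h₀ + D y with D = 2^(α-β) and y < 2^β.  As D² ≡ 0 modulo q = 2^α, the inverse of h₀ + D y is
-- h₀'(1 - D y h₀'), so the sum over y is a geometric sum of 2^β-th roots of unity; it vanishes unless
-- h₀'² ≡ 1 modulo 2^β, that is unless h₀ ≡ ±1 modulo 2^(β-1).  For β ≥ 3 the surviving h₀ = ±1 + Y,
-- Y = 2^(β-1) J, have Y⁴ ≡ 0 modulo q, so their inverse is the truncated geometric series (±1 - Y)(1 + Y²),
-- and the remaining terms are evaluated by reducing their exponents modulo q.  The ring laws of the coefficient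
-- model of ℤ[ζ] come from writing its product in Horner form over multiplication by ζ, a linear map with ζⁿ = -1.

module Submission where

open import Defs
open import Data.Nat as ℕ using (ℕ; zero; suc; _≤_; _<_; z≤n; s≤s; _^_; _∸_; NonZero)
import Data.Nat
import Data.Nat.Properties as ℕP
import Data.Nat.Divisibility as ℕD
open import Data.Nat.GCD using (gcd; gcd[m,n]∣m; gcd[m,n]∣n; gcd-greatest; module Bézout)
open import Data.Nat.Coprimality using (Coprime; coprime-divisor; gcd≡1⇒coprime; coprime-Bézout)
import Data.Nat.Tactic.RingSolver as ℕ-Solver
open import Data.Integer as ℤ using (ℤ; +_; -[1+_]; _+_; _*_; -_; _-_)
import Data.Integer.Properties as ℤP
open import Data.Integer.DivMod using (_%ℕ_; _/ℕ_; a≡a%ℕn+[a/ℕn]*n; n%ℕd<d)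
open import Data.Integer.Divisibility.Signed as ℤD using (divides; _∣_)
open import Data.Integer.Tactic.RingSolver using (solve-∀)
open import Data.Vec using (Vec; []; _∷_; _∷ʳ_; zipWith; map; toList; initLast)
import Data.Vec.Properties as VP
open import Data.Vec.Relation.Binary.Pointwise.Inductive using (Pointwise-≡⇒≡; zipWith-comm; zipWith-assoc; zipWith-identityˡ)
open import Data.Vec.Relation.Binary.Equality.Cast using (cast-is-id)
open import Data.List as List using (List; _++_; [_]; length) renaming ([] to []ᴸ; _∷_ to _∷ᴸ_)
import Data.List.Properties as LP
open import Data.Bool using (Bool; true; false; if_then_else_)
open import Data.Product using (_×_; _,_; Σ; proj₁; proj₂)
open import Data.Sum using (_⊎_; inj₁; inj₂)
open import Data.Empty using (⊥-elim)
open import Relation.Nullary using (¬_; yes; no)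
open import Relation.Binary.PropositionalEquality hiding ([_])
open import Function using (_∘_)

-- Arithmetic in ℤ[ζ] = ℤ[x]/(xⁿ + 1)

⊕-comm : ∀ {n} (a b : Vec ℤ n) → a ⊕ b ≡ b ⊕ a
⊕-comm a b = Pointwise-≡⇒≡ (zipWith-comm ℤP.+-comm a b)

⊕-assoc : ∀ {n} (a b c : Vec ℤ n) → (a ⊕ b) ⊕ c ≡ a ⊕ (b ⊕ c)
⊕-assoc a b c = Pointwise-≡⇒≡ (zipWith-assoc ℤP.+-assoc a b c)

⊕-identityˡ : ∀ {n} (a : Vec ℤ n) → 0c ⊕ a ≡ a
⊕-identityˡ a = Pointwise-≡⇒≡ (zipWith-identityˡ ℤP.+-identityˡ a)

⊕-identityʳ : ∀ {n} (a : Vec ℤ n) → a ⊕ 0c ≡ a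
⊕-identityʳ a = trans (⊕-comm a 0c) (⊕-identityˡ a)

⊕-inverseʳ : ∀ {n} (a : Vec ℤ n) → a ⊕ ⊖ a ≡ 0c
⊕-inverseʳ []      = refl
⊕-inverseʳ (x ∷ a) = cong₂ _∷_ (ℤP.+-inverseʳ x) (⊕-inverseʳ a)

⊕-interchange : ∀ {n} (a b c d : Vec ℤ n) → (a ⊕ b) ⊕ (c ⊕ d) ≡ (a ⊕ c) ⊕ (b ⊕ d)
⊕-interchange a b c d = begin
  (a ⊕ b) ⊕ (c ⊕ d) ≡⟨ ⊕-assoc a b (c ⊕ d) ⟩
  a ⊕ (b ⊕ (c ⊕ d)) ≡⟨ cong (a ⊕_) (sym (⊕-assoc b c d)) ⟩
  a ⊕ ((b ⊕ c) ⊕ d) ≡⟨ cong (λ z → a ⊕ (z ⊕ d)) (⊕-comm b c) ⟩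
  a ⊕ ((c ⊕ b) ⊕ d) ≡⟨ cong (a ⊕_) (⊕-assoc c b d) ⟩
  a ⊕ (c ⊕ (b ⊕ d)) ≡⟨ sym (⊕-assoc a c (b ⊕ d)) ⟩
  (a ⊕ c) ⊕ (b ⊕ d) ∎
  where open ≡-Reasoning

·-distribˡ-⊕ : ∀ {n} c (a b : Vec ℤ n) → c · (a ⊕ b) ≡ c · a ⊕ c · b
·-distribˡ-⊕ c []      []      = refl
·-distribˡ-⊕ c (x ∷ a) (y ∷ b) = cong₂ _∷_ (ℤP.*-distribˡ-+ c x y) (·-distribˡ-⊕ c a b)

·-distribʳ-+ : ∀ {n} c d (a : Vec ℤ n) → (c + d) · a ≡ c · a ⊕ d · a
·-distribʳ-+ c d []      = refl
·-distribʳ-+ c d (x ∷ a) = cong₂ _∷_ (ℤP.*-distribʳ-+ x c d) (·-distribʳ-+ c d a)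

·-assoc : ∀ {n} c d (a : Vec ℤ n) → (c * d) · a ≡ c · (d · a)
·-assoc c d []      = refl
·-assoc c d (x ∷ a) = cong₂ _∷_ (ℤP.*-assoc c d x) (·-assoc c d a)

·-identityˡ : ∀ {n} (a : Vec ℤ n) → (+ 1) · a ≡ a
·-identityˡ []      = refl
·-identityˡ (x ∷ a) = cong₂ _∷_ (ℤP.*-identityˡ x) (·-identityˡ a)

·-zeroˡ : ∀ {n} (a : Vec ℤ n) → (+ 0) · a ≡ 0c
·-zeroˡ []      = refl
·-zeroˡ (x ∷ a) = cong (+ 0 ∷_) (·-zeroˡ a)

·-zeroʳ : ∀ {n} c → c · 0c {n} ≡ 0c
·-zeroʳ {zero}  c = refl
·-zeroʳ {suc n} c = cong₂ _∷_ (ℤP.*-zeroʳ c) (·-zeroʳ c)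

⊖≡-1· : ∀ {n} (a : Vec ℤ n) → ⊖ a ≡ (- + 1) · a
⊖≡-1· []      = refl
⊖≡-1· (x ∷ a) = cong₂ _∷_ (sym (ℤP.-1*i≡-i x)) (⊖≡-1· a)

·-⊖ : ∀ {n} c (a : Vec ℤ n) → c · (⊖ a) ≡ (- c) · a
·-⊖ c []      = refl
·-⊖ c (x ∷ a) = cong₂ _∷_ (trans (sym (ℤP.neg-distribʳ-* c x)) (ℤP.neg-distribˡ-* c x)) (·-⊖ c a)

⊖-involutive : ∀ {n} (a : Vec ℤ n) → ⊖ (⊖ a) ≡ a
⊖-involutive []      = refl
⊖-involutive (x ∷ a) = cong₂ _∷_ (ℤP.neg-involutive x) (⊖-involutive a)

·-comm : ∀ {n} c d (a : Vec ℤ n) → c · (d · a) ≡ d · (c · a)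
·-comm c d a = begin
  c · (d · a) ≡⟨ sym (·-assoc c d a) ⟩
  (c * d) · a ≡⟨ cong (_· a) (ℤP.*-comm c d) ⟩
  (d * c) · a ≡⟨ ·-assoc d c a ⟩
  d · (c · a) ∎
  where open ≡-Reasoning

·-double : ∀ {n} (a : Vec ℤ n) → (+ 2) · a ≡ a ⊕ a
·-double a = trans (·-distribʳ-+ (+ 1) (+ 1) a) (cong₂ _⊕_ (·-identityˡ a) (·-identityˡ a))

zipWith-∷ʳ : ∀ {A B C : Set} {n} (f : A → B → C) x y (a : Vec A n) (b : Vec B n) →
             zipWith f (a ∷ʳ x) (b ∷ʳ y) ≡ zipWith f a b ∷ʳ f x y
zipWith-∷ʳ f x y []      []      = refl
zipWith-∷ʳ f x y (u ∷ a) (v ∷ b) = cong (f u v ∷_) (zipWith-∷ʳ f x y a b)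

mulζ-∷ʳ : ∀ {n} (a : Vec ℤ n) x → mulζ (a ∷ʳ x) ≡ - x ∷ a
mulζ-∷ʳ []      x = refl
mulζ-∷ʳ (y ∷ a) x = cong₂ (λ p r → - p ∷ r) (VP.last-∷ʳ x (y ∷ a)) (VP.init-∷ʳ x (y ∷ a))

mulζ-⊕ : ∀ {n} (a b : Vec ℤ n) → mulζ (a ⊕ b) ≡ mulζ a ⊕ mulζ b
mulζ-⊕ {zero}  [] [] = refl
mulζ-⊕ {suc n} a  b  with initLast a | initLast b
... | a′ , x , refl | b′ , y , refl = begin
  mulζ (zipWith _+_ (a′ ∷ʳ x) (b′ ∷ʳ y)) ≡⟨ cong mulζ (zipWith-∷ʳ _+_ x y a′ b′) ⟩
  mulζ ((a′ ⊕ b′) ∷ʳ (x + y))          ≡⟨ mulζ-∷ʳ (a′ ⊕ b′) (x + y) ⟩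
  - (x + y) ∷ (a′ ⊕ b′)                 ≡⟨ cong (_∷ (a′ ⊕ b′)) (ℤP.neg-distrib-+ x y) ⟩
  (- x ∷ a′) ⊕ (- y ∷ b′)               ≡⟨ sym (cong₂ _⊕_ (mulζ-∷ʳ a′ x) (mulζ-∷ʳ b′ y)) ⟩
  mulζ (a′ ∷ʳ x) ⊕ mulζ (b′ ∷ʳ y)       ∎
  where open ≡-Reasoning

mulζ-· : ∀ {n} c (a : Vec ℤ n) → mulζ (c · a) ≡ c · mulζ a
mulζ-· {zero}  c [] = refl
mulζ-· {suc n} c a  with initLast a
... | a′ , x , refl = begin
  mulζ (map (c *_) (a′ ∷ʳ x)) ≡⟨ cong mulζ (VP.map-∷ʳ (c *_) x a′) ⟩
  mulζ ((c · a′) ∷ʳ (c * x))  ≡⟨ mulζ-∷ʳ (c · a′) (c * x) ⟩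
  - (c * x) ∷ (c · a′)        ≡⟨ cong (_∷ (c · a′)) (ℤP.neg-distribʳ-* c x) ⟩
  c · (- x ∷ a′)              ≡⟨ sym (cong (c ·_) (mulζ-∷ʳ a′ x)) ⟩
  c · mulζ (a′ ∷ʳ x)          ∎
  where open ≡-Reasoning

mulζ⁻¹-⊕ : ∀ {n} (a b : Vec ℤ n) → mulζ⁻¹ (a ⊕ b) ≡ mulζ⁻¹ a ⊕ mulζ⁻¹ b
mulζ⁻¹-⊕ []      []      = refl
mulζ⁻¹-⊕ (x ∷ a) (y ∷ b) =
  trans (cong ((a ⊕ b) ∷ʳ_) (ℤP.neg-distrib-+ x y)) (sym (zipWith-∷ʳ _+_ (- x) (- y) a b))

mulζ⁻¹-· : ∀ {n} c (a : Vec ℤ n) → mulζ⁻¹ (c · a) ≡ c · mulζ⁻¹ a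
mulζ⁻¹-· c []      = refl
mulζ⁻¹-· c (x ∷ a) =
  trans (cong ((c · a) ∷ʳ_) (ℤP.neg-distribʳ-* c x)) (sym (VP.map-∷ʳ (c *_) (- x) a))

mulζ∘mulζ⁻¹ : ∀ {n} (a : Vec ℤ n) → mulζ (mulζ⁻¹ a) ≡ a
mulζ∘mulζ⁻¹ []      = refl
mulζ∘mulζ⁻¹ (x ∷ a) = trans (mulζ-∷ʳ a (- x)) (cong (_∷ a) (ℤP.neg-involutive x))

mulζ⁻¹∘mulζ : ∀ {n} (a : Vec ℤ n) → mulζ⁻¹ (mulζ a) ≡ a
mulζ⁻¹∘mulζ {zero}  [] = refl
mulζ⁻¹∘mulζ {suc n} a  with initLast a
... | a′ , x , refl = trans (cong mulζ⁻¹ (mulζ-∷ʳ a′ x)) (cong (a′ ∷ʳ_) (ℤP.neg-involutive x))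

iter-suc : ∀ {A : Set} k (f : A → A) a → iter (suc k) f a ≡ iter k f (f a)
iter-suc zero    f a = refl
iter-suc (suc k) f a = cong f (iter-suc k f a)

iter-+ : ∀ {A : Set} k m (f : A → A) a → iter (k ℕ.+ m) f a ≡ iter k f (iter m f a)
iter-+ zero    m f a = refl
iter-+ (suc k) m f a = cong f (iter-+ k m f a)

iter-commute : ∀ {A : Set} k (f g : A → A) → (∀ a → f (g a) ≡ g (f a)) →
               ∀ a → iter k f (g a) ≡ g (iter k f a)
iter-commute zero    f g fg a = refl
iter-commute (suc k) f g fg a = trans (cong f (iter-commute k f g fg a)) (fg _)

iter-inverse : ∀ {A : Set} k (f g : A → A) → (∀ a → f (g a) ≡ a) → ∀ a → iter k f (iter k g a) ≡ a
iter-inverse zero    f g fg a = refl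
iter-inverse (suc k) f g fg a =
  trans (iter-suc k f _) (trans (cong (iter k f) (fg _)) (iter-inverse k f g fg a))

rotateNeg : List ℤ → List ℤ
rotateNeg []ᴸ       = []ᴸ
rotateNeg (x ∷ᴸ xs) = xs ++ [ - x ]

toList-mulζ⁻¹ : ∀ {n} (v : Vec ℤ n) → toList (mulζ⁻¹ v) ≡ rotateNeg (toList v)
toList-mulζ⁻¹ []      = refl
toList-mulζ⁻¹ (x ∷ v) = VP.toList-∷ʳ (- x) v

toList-iter-mulζ⁻¹ : ∀ {n} k (v : Vec ℤ n) → toList (iter k mulζ⁻¹ v) ≡ iter k rotateNeg (toList v)
toList-iter-mulζ⁻¹ zero    v = refl
toList-iter-mulζ⁻¹ (suc k) v = trans (toList-mulζ⁻¹ (iter k mulζ⁻¹ v)) (cong rotateNeg (toList-iter-mulζ⁻¹ k v))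

iter-rotateNeg : ∀ (xs ys : List ℤ) → iter (length xs) rotateNeg (xs ++ ys) ≡ ys ++ List.map -_ xs
iter-rotateNeg []ᴸ       ys = sym (LP.++-identityʳ ys)
iter-rotateNeg (x ∷ᴸ xs) ys = begin
  iter (suc (length xs)) rotateNeg (x ∷ᴸ xs ++ ys)    ≡⟨ iter-suc (length xs) rotateNeg _ ⟩
  iter (length xs) rotateNeg ((xs ++ ys) ++ [ - x ]) ≡⟨ cong (iter (length xs) rotateNeg) (LP.++-assoc xs ys _) ⟩
  iter (length xs) rotateNeg (xs ++ (ys ++ [ - x ])) ≡⟨ iter-rotateNeg xs (ys ++ [ - x ]) ⟩
  (ys ++ [ - x ]) ++ List.map -_ xs                   ≡⟨ LP.++-assoc ys _ _ ⟩
  ys ++ (- x ∷ᴸ List.map -_ xs)                       ∎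
  where open ≡-Reasoning

iter-mulζ⁻¹-n : ∀ {n} (v : Vec ℤ n) → iter n mulζ⁻¹ v ≡ ⊖ v
iter-mulζ⁻¹-n {n} v = trans (sym (cast-is-id refl _)) (VP.toList-injective refl _ _ (begin
  toList (iter n mulζ⁻¹ v)                           ≡⟨ toList-iter-mulζ⁻¹ n v ⟩
  iter n rotateNeg (toList v)                        ≡⟨ cong (λ k → iter k rotateNeg (toList v)) (sym (VP.length-toList v)) ⟩
  iter (length (toList v)) rotateNeg (toList v)      ≡⟨ cong (iter (length (toList v)) rotateNeg) (sym (LP.++-identityʳ (toList v))) ⟩
  iter (length (toList v)) rotateNeg (toList v ++ []ᴸ) ≡⟨ iter-rotateNeg (toList v) []ᴸ ⟩
  List.map -_ (toList v)                             ≡⟨ sym (VP.toList-map -_ v) ⟩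
  toList (⊖ v)                                       ∎))
  where open ≡-Reasoning

mulζ-⊖ : ∀ {n} (a : Vec ℤ n) → mulζ (⊖ a) ≡ ⊖ mulζ a
mulζ-⊖ a = trans (cong mulζ (⊖≡-1· a)) (trans (mulζ-· (- + 1) a) (sym (⊖≡-1· (mulζ a))))

iter-mulζ-n : ∀ {n} (v : Vec ℤ n) → iter n mulζ v ≡ ⊖ v
iter-mulζ-n {n} v = begin
  iter n mulζ v                    ≡⟨ cong (iter n mulζ) (sym (⊖-involutive v)) ⟩
  iter n mulζ (⊖ ⊖ v)              ≡⟨ cong (λ z → iter n mulζ (⊖ z)) (sym (iter-mulζ⁻¹-n v)) ⟩
  iter n mulζ (⊖ iter n mulζ⁻¹ v)  ≡⟨ iter-commute n mulζ ⊖_ mulζ-⊖ _ ⟩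
  ⊖ iter n mulζ (iter n mulζ⁻¹ v)  ≡⟨ cong ⊖_ (iter-inverse n mulζ mulζ⁻¹ mulζ∘mulζ⁻¹ v) ⟩
  ⊖ v                              ∎
  where open ≡-Reasoning

iter-mulζ-2n : ∀ {n} (v : Vec ℤ n) → iter (n ℕ.+ n) mulζ v ≡ v
iter-mulζ-2n {n} v = begin
  iter (n ℕ.+ n) mulζ v   ≡⟨ iter-+ n n mulζ v ⟩
  iter n mulζ (iter n mulζ v) ≡⟨ cong (iter n mulζ) (iter-mulζ-n v) ⟩
  iter n mulζ (⊖ v)       ≡⟨ iter-mulζ-n (⊖ v) ⟩
  ⊖ ⊖ v                   ≡⟨ ⊖-involutive v ⟩
  v                       ∎
  where open ≡-Reasoning

hornerWith : ∀ {n} → (Vec ℤ n → Vec ℤ n) → List ℤ → Vec ℤ n → Vec ℤ n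
hornerWith f []ᴸ       x = 0c
hornerWith f (c ∷ᴸ cs) x = c · x ⊕ f (hornerWith f cs x)

module Linear {n} (f : Vec ℤ n → Vec ℤ n)
  (f-⊕ : ∀ a b → f (a ⊕ b) ≡ f a ⊕ f b) (f-· : ∀ c a → f (c · a) ≡ c · f a) where

  f-0c : f 0c ≡ 0c
  f-0c = trans (cong f (sym (·-zeroˡ 0c))) (trans (f-· (+ 0) 0c) (·-zeroˡ _))

  hornerWith-⊕ʳ : ∀ cs a b → hornerWith f cs (a ⊕ b) ≡ hornerWith f cs a ⊕ hornerWith f cs b
  hornerWith-⊕ʳ []ᴸ       a b = sym (⊕-identityˡ 0c)
  hornerWith-⊕ʳ (c ∷ᴸ cs) a b = begin
    c · (a ⊕ b) ⊕ f (hornerWith f cs (a ⊕ b))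
      ≡⟨ cong₂ _⊕_ (·-distribˡ-⊕ c a b) (trans (cong f (hornerWith-⊕ʳ cs a b)) (f-⊕ _ _)) ⟩
    (c · a ⊕ c · b) ⊕ (f (hornerWith f cs a) ⊕ f (hornerWith f cs b))
      ≡⟨ ⊕-interchange _ _ _ _ ⟩
    (c · a ⊕ f (hornerWith f cs a)) ⊕ (c · b ⊕ f (hornerWith f cs b)) ∎
    where open ≡-Reasoning

  hornerWith-·ʳ : ∀ cs d a → hornerWith f cs (d · a) ≡ d · hornerWith f cs a
  hornerWith-·ʳ []ᴸ       d a = sym (·-zeroʳ d)
  hornerWith-·ʳ (c ∷ᴸ cs) d a = begin
    c · (d · a) ⊕ f (hornerWith f cs (d · a))
      ≡⟨ cong₂ _⊕_ (·-comm c d a) (trans (cong f (hornerWith-·ʳ cs d a)) (f-· d _)) ⟩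
    d · (c · a) ⊕ d · f (hornerWith f cs a)
      ≡⟨ sym (·-distribˡ-⊕ d _ _) ⟩
    d · (c · a ⊕ f (hornerWith f cs a)) ∎
    where open ≡-Reasoning

  hornerWith-f : ∀ cs a → hornerWith f cs (f a) ≡ f (hornerWith f cs a)
  hornerWith-f []ᴸ       a = sym f-0c
  hornerWith-f (c ∷ᴸ cs) a = begin
    c · f a ⊕ f (hornerWith f cs (f a))   ≡⟨ cong₂ _⊕_ (sym (f-· c a)) (cong f (hornerWith-f cs a)) ⟩
    f (c · a) ⊕ f (f (hornerWith f cs a)) ≡⟨ sym (f-⊕ _ _) ⟩
    f (c · a ⊕ f (hornerWith f cs a))     ∎
    where open ≡-Reasoning

  hornerWith-∷ʳ : ∀ cs c x → hornerWith f (cs ++ [ c ]) x ≡ hornerWith f cs x ⊕ c · iter (length cs) f x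
  hornerWith-∷ʳ []ᴸ       c x = trans (cong (c · x ⊕_) f-0c) (trans (⊕-identityʳ _) (sym (⊕-identityˡ _)))
  hornerWith-∷ʳ (d ∷ᴸ cs) c x = begin
    d · x ⊕ f (hornerWith f (cs ++ [ c ]) x)
      ≡⟨ cong (λ z → d · x ⊕ f z) (hornerWith-∷ʳ cs c x) ⟩
    d · x ⊕ f (hornerWith f cs x ⊕ c · iter (length cs) f x)
      ≡⟨ cong (d · x ⊕_) (trans (f-⊕ _ _) (cong (f (hornerWith f cs x) ⊕_) (f-· c _))) ⟩
    d · x ⊕ (f (hornerWith f cs x) ⊕ c · iter (suc (length cs)) f x)
      ≡⟨ sym (⊕-assoc _ _ _) ⟩
    (d · x ⊕ f (hornerWith f cs x)) ⊕ c · iter (suc (length cs)) f x ∎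
    where open ≡-Reasoning

  hornerWith-⊕ˡ : ∀ {m} (a b : Vec ℤ m) x →
                  hornerWith f (toList (a ⊕ b)) x ≡ hornerWith f (toList a) x ⊕ hornerWith f (toList b) x
  hornerWith-⊕ˡ []        []        x = sym (⊕-identityˡ 0c)
  hornerWith-⊕ˡ (a₀ ∷ a) (b₀ ∷ b) x = begin
    (a₀ + b₀) · x ⊕ f (hornerWith f (toList (a ⊕ b)) x)
      ≡⟨ cong₂ _⊕_ (·-distribʳ-+ a₀ b₀ x) (trans (cong f (hornerWith-⊕ˡ a b x)) (f-⊕ _ _)) ⟩
    (a₀ · x ⊕ b₀ · x) ⊕ (f (hornerWith f (toList a) x) ⊕ f (hornerWith f (toList b) x))
      ≡⟨ ⊕-interchange _ _ _ _ ⟩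
    (a₀ · x ⊕ f (hornerWith f (toList a) x)) ⊕ (b₀ · x ⊕ f (hornerWith f (toList b) x)) ∎
    where open ≡-Reasoning

  hornerWith-·ˡ : ∀ {m} d (a : Vec ℤ m) x → hornerWith f (toList (d · a)) x ≡ d · hornerWith f (toList a) x
  hornerWith-·ˡ d []       x = sym (·-zeroʳ d)
  hornerWith-·ˡ d (a₀ ∷ a) x = begin
    (d * a₀) · x ⊕ f (hornerWith f (toList (d · a)) x)
      ≡⟨ cong₂ _⊕_ (·-assoc d a₀ x) (trans (cong f (hornerWith-·ˡ d a x)) (f-· d _)) ⟩
    d · (a₀ · x) ⊕ d · f (hornerWith f (toList a) x)
      ≡⟨ sym (·-distribˡ-⊕ d _ _) ⟩
    d · (a₀ · x ⊕ f (hornerWith f (toList a) x)) ∎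
    where open ≡-Reasoning

  hornerWith-0cˡ : ∀ {m} x → hornerWith f (toList (0c {m})) x ≡ 0c
  hornerWith-0cˡ {zero}  x = refl
  hornerWith-0cˡ {suc m} x =
    trans (cong₂ _⊕_ (·-zeroˡ x) (trans (cong f (hornerWith-0cˡ {m} x)) f-0c)) (⊕-identityˡ 0c)

  hornerWith-toList-∷ʳ : ∀ {m} (a : Vec ℤ m) c x →
                         hornerWith f (toList (a ∷ʳ c)) x ≡ hornerWith f (toList a) x ⊕ c · iter m f x
  hornerWith-toList-∷ʳ {m} a c x = begin
    hornerWith f (toList (a ∷ʳ c)) x                              ≡⟨ cong (λ cs → hornerWith f cs x) (VP.toList-∷ʳ c a) ⟩
    hornerWith f (toList a ++ [ c ]) x                            ≡⟨ hornerWith-∷ʳ (toList a) c x ⟩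
    hornerWith f (toList a) x ⊕ c · iter (length (toList a)) f x  ≡⟨ cong (λ k → hornerWith f (toList a) x ⊕ c · iter k f x) (VP.length-toList a) ⟩
    hornerWith f (toList a) x ⊕ c · iter m f x                    ∎
    where open ≡-Reasoning

  -- Shifting the coefficients by ζ commutes with f because f, like ζ, satisfies fᵐ = -1.
  hornerWith-mulζˡ : ∀ {m} → (∀ v → iter m f v ≡ ⊖ v) →
                     ∀ (a : Vec ℤ m) x → hornerWith f (toList (mulζ a)) x ≡ f (hornerWith f (toList a) x)
  hornerWith-mulζˡ {zero}  fᵐ≡-1 [] x = sym f-0c
  hornerWith-mulζˡ {suc m} fᵐ≡-1 a  x with initLast a
  ... | a′ , c , refl = begin
    hornerWith f (toList (mulζ (a′ ∷ʳ c))) x ≡⟨ cong (λ z → hornerWith f (toList z) x) (mulζ-∷ʳ a′ c) ⟩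
    (- c) · x ⊕ f H                          ≡⟨ ⊕-comm _ _ ⟩
    f H ⊕ (- c) · x                          ≡⟨ cong (f H ⊕_) (sym wrapped) ⟩
    f H ⊕ f (c · iter m f x)                 ≡⟨ sym (f-⊕ _ _) ⟩
    f (H ⊕ c · iter m f x)                   ≡⟨ cong f (sym (hornerWith-toList-∷ʳ a′ c x)) ⟩
    f (hornerWith f (toList (a′ ∷ʳ c)) x)    ∎
    where
    open ≡-Reasoning
    H = hornerWith f (toList a′) x
    wrapped : f (c · iter m f x) ≡ (- c) · x
    wrapped = trans (f-· c _) (trans (cong (c ·_) (fᵐ≡-1 x)) (·-⊖ c x))

module Mulζ {n} = Linear {n} mulζ mulζ-⊕ mulζ-·
module Mulζ⁻¹ {n} = Linear {n} mulζ⁻¹ mulζ⁻¹-⊕ mulζ⁻¹-·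

⊛≡hornerWith : ∀ {n} (a b : Vec ℤ n) → a ⊛ b ≡ hornerWith mulζ (toList a) b
⊛≡hornerWith a b = horner≡hornerWith (toList a)
  where
  horner≡hornerWith : ∀ cs → horner cs b ≡ hornerWith mulζ cs b
  horner≡hornerWith []ᴸ       = refl
  horner≡hornerWith (c ∷ᴸ cs) = cong (λ z → c · b ⊕ mulζ z) (horner≡hornerWith cs)

⊛-distribʳ : ∀ {n} (a a′ b : Vec ℤ n) → (a ⊕ a′) ⊛ b ≡ a ⊛ b ⊕ a′ ⊛ b
⊛-distribʳ a a′ b = begin
  (a ⊕ a′) ⊛ b                                                ≡⟨ ⊛≡hornerWith (a ⊕ a′) b ⟩
  hornerWith mulζ (toList (a ⊕ a′)) b                         ≡⟨ Mulζ.hornerWith-⊕ˡ a a′ b ⟩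
  hornerWith mulζ (toList a) b ⊕ hornerWith mulζ (toList a′) b ≡⟨ sym (cong₂ _⊕_ (⊛≡hornerWith a b) (⊛≡hornerWith a′ b)) ⟩
  a ⊛ b ⊕ a′ ⊛ b                                              ∎
  where open ≡-Reasoning

⊛-distribˡ : ∀ {n} (a b b′ : Vec ℤ n) → a ⊛ (b ⊕ b′) ≡ a ⊛ b ⊕ a ⊛ b′
⊛-distribˡ a b b′ = begin
  a ⊛ (b ⊕ b′)                                                ≡⟨ ⊛≡hornerWith a (b ⊕ b′) ⟩
  hornerWith mulζ (toList a) (b ⊕ b′)                         ≡⟨ Mulζ.hornerWith-⊕ʳ (toList a) b b′ ⟩
  hornerWith mulζ (toList a) b ⊕ hornerWith mulζ (toList a) b′ ≡⟨ sym (cong₂ _⊕_ (⊛≡hornerWith a b) (⊛≡hornerWith a b′)) ⟩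
  a ⊛ b ⊕ a ⊛ b′                                              ∎
  where open ≡-Reasoning

·-⊛ : ∀ {n} c (a b : Vec ℤ n) → (c · a) ⊛ b ≡ c · (a ⊛ b)
·-⊛ c a b = trans (⊛≡hornerWith (c · a) b) (trans (Mulζ.hornerWith-·ˡ c a b) (cong (c ·_) (sym (⊛≡hornerWith a b))))

⊛-· : ∀ {n} c (a b : Vec ℤ n) → a ⊛ (c · b) ≡ c · (a ⊛ b)
⊛-· c a b = trans (⊛≡hornerWith a (c · b)) (trans (Mulζ.hornerWith-·ʳ (toList a) c b) (cong (c ·_) (sym (⊛≡hornerWith a b))))

mulζ-⊛ : ∀ {n} (a b : Vec ℤ n) → mulζ a ⊛ b ≡ mulζ (a ⊛ b)
mulζ-⊛ a b = begin
  mulζ a ⊛ b                                 ≡⟨ ⊛≡hornerWith (mulζ a) b ⟩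
  hornerWith mulζ (toList (mulζ a)) b        ≡⟨ Mulζ.hornerWith-mulζˡ iter-mulζ-n a b ⟩
  mulζ (hornerWith mulζ (toList a) b)        ≡⟨ cong mulζ (sym (⊛≡hornerWith a b)) ⟩
  mulζ (a ⊛ b)                               ∎
  where open ≡-Reasoning

⊛-mulζ : ∀ {n} (a b : Vec ℤ n) → a ⊛ mulζ b ≡ mulζ (a ⊛ b)
⊛-mulζ a b = trans (⊛≡hornerWith a (mulζ b)) (trans (Mulζ.hornerWith-f (toList a) b) (cong mulζ (sym (⊛≡hornerWith a b))))

⊛-mulζ⁻¹ : ∀ {n} (a b : Vec ℤ n) → a ⊛ mulζ⁻¹ b ≡ mulζ⁻¹ (a ⊛ b)
⊛-mulζ⁻¹ a b = begin
  a ⊛ mulζ⁻¹ b                     ≡⟨ sym (mulζ⁻¹∘mulζ _) ⟩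
  mulζ⁻¹ (mulζ (a ⊛ mulζ⁻¹ b))     ≡⟨ cong mulζ⁻¹ (sym (⊛-mulζ a (mulζ⁻¹ b))) ⟩
  mulζ⁻¹ (a ⊛ mulζ (mulζ⁻¹ b))     ≡⟨ cong (λ z → mulζ⁻¹ (a ⊛ z)) (mulζ∘mulζ⁻¹ b) ⟩
  mulζ⁻¹ (a ⊛ b)                   ∎
  where open ≡-Reasoning

⊛-zeroˡ : ∀ {n} (b : Vec ℤ n) → 0c ⊛ b ≡ 0c
⊛-zeroˡ {n} b = trans (⊛≡hornerWith (0c {n}) b) (Mulζ.hornerWith-0cˡ {n} {n} b)

⊛-zeroʳ : ∀ {n} (a : Vec ℤ n) → a ⊛ 0c ≡ 0c
⊛-zeroʳ a = trans (cong (a ⊛_) (sym (·-zeroˡ 0c))) (trans (⊛-· (+ 0) a 0c) (·-zeroˡ _))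

⊛-⊖ : ∀ {n} (a b : Vec ℤ n) → a ⊛ ⊖ b ≡ ⊖ (a ⊛ b)
⊛-⊖ a b = trans (cong (a ⊛_) (⊖≡-1· b)) (trans (⊛-· (- + 1) a b) (sym (⊖≡-1· (a ⊛ b))))

⊛-assoc : ∀ {n} (a b c : Vec ℤ n) → (a ⊛ b) ⊛ c ≡ a ⊛ (b ⊛ c)
⊛-assoc a b c = begin
  (a ⊛ b) ⊛ c                             ≡⟨ cong (_⊛ c) (⊛≡hornerWith a b) ⟩
  hornerWith mulζ (toList a) b ⊛ c        ≡⟨ hornerWith-⊛ (toList a) ⟩
  hornerWith mulζ (toList a) (b ⊛ c)      ≡⟨ sym (⊛≡hornerWith a (b ⊛ c)) ⟩
  a ⊛ (b ⊛ c)                             ∎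
  where
  open ≡-Reasoning
  hornerWith-⊛ : ∀ cs → hornerWith mulζ cs b ⊛ c ≡ hornerWith mulζ cs (b ⊛ c)
  hornerWith-⊛ []ᴸ       = ⊛-zeroˡ c
  hornerWith-⊛ (d ∷ᴸ cs) = trans (⊛-distribʳ (d · b) (mulζ (hornerWith mulζ cs b)) c)
    (cong₂ _⊕_ (·-⊛ d b c) (trans (mulζ-⊛ (hornerWith mulζ cs b) c) (cong mulζ (hornerWith-⊛ cs))))

padTo : (N : ℕ) → List ℤ → Vec ℤ N
padTo zero    _         = []
padTo (suc N) []ᴸ       = 0c
padTo (suc N) (c ∷ᴸ cs) = c ∷ padTo N cs

padTo-[] : ∀ N → padTo N []ᴸ ≡ 0c
padTo-[] zero    = refl
padTo-[] (suc N) = refl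

0c-∷ʳ : ∀ N → 0c {suc N} ≡ 0c {N} ∷ʳ + 0
0c-∷ʳ zero    = refl
0c-∷ʳ (suc N) = cong (+ 0 ∷_) (0c-∷ʳ N)

padTo-suc : ∀ N cs → length cs ≤ N → padTo (suc N) cs ≡ padTo N cs ∷ʳ + 0
padTo-suc N       []ᴸ       _         = trans (0c-∷ʳ N) (cong (_∷ʳ + 0) (sym (padTo-[] N)))
padTo-suc (suc N) (c ∷ᴸ cs) (s≤s |cs|≤N) = cong (c ∷_) (padTo-suc N cs |cs|≤N)

padTo-toList : ∀ {N} (a : Vec ℤ N) → padTo N (toList a) ≡ a
padTo-toList []      = refl
padTo-toList (x ∷ a) = cong (x ∷_) (padTo-toList a)

hornerWith-mulζ-1c : ∀ N cs → length cs ≤ N → hornerWith mulζ cs (1c {N}) ≡ padTo N cs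
hornerWith-mulζ-1c N       []ᴸ       _            = sym (padTo-[] N)
hornerWith-mulζ-1c (suc N) (c ∷ᴸ cs) (s≤s |cs|≤N) = begin
  c · 1c ⊕ mulζ (hornerWith mulζ cs 1c) ≡⟨ cong (λ z → c · 1c ⊕ mulζ z) (hornerWith-mulζ-1c (suc N) cs (ℕP.m≤n⇒m≤1+n |cs|≤N)) ⟩
  c · 1c ⊕ mulζ (padTo (suc N) cs)      ≡⟨ cong (λ z → c · 1c ⊕ mulζ z) (padTo-suc N cs |cs|≤N) ⟩
  c · 1c ⊕ mulζ (padTo N cs ∷ʳ + 0)     ≡⟨ cong (c · 1c ⊕_) (mulζ-∷ʳ (padTo N cs) (+ 0)) ⟩
  (c * + 1 + + 0) ∷ (c · 0c ⊕ padTo N cs) ≡⟨ cong₂ _∷_ (trans (ℤP.+-identityʳ _) (ℤP.*-identityʳ c)) (trans (cong (_⊕ padTo N cs) (·-zeroʳ c)) (⊕-identityˡ _)) ⟩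
  c ∷ padTo N cs                        ∎
  where open ≡-Reasoning

⊛-identityʳ : ∀ {n} (a : Vec ℤ n) → a ⊛ 1c ≡ a
⊛-identityʳ {n} a = begin
  a ⊛ 1c                         ≡⟨ ⊛≡hornerWith a 1c ⟩
  hornerWith mulζ (toList a) 1c  ≡⟨ hornerWith-mulζ-1c n (toList a) (ℕP.≤-reflexive (VP.length-toList a)) ⟩
  padTo n (toList a)             ≡⟨ padTo-toList a ⟩
  a                              ∎
  where open ≡-Reasoning

hornerWith-mulζ-swap : ∀ {n} cs ds (x : Vec ℤ n) →
                       hornerWith mulζ cs (hornerWith mulζ ds x) ≡ hornerWith mulζ ds (hornerWith mulζ cs x)
hornerWith-mulζ-swap cs []ᴸ       x =
  trans (cong (hornerWith mulζ cs) (sym (·-zeroˡ 0c))) (trans (Mulζ.hornerWith-·ʳ cs (+ 0) 0c) (·-zeroˡ _))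
hornerWith-mulζ-swap cs (d ∷ᴸ ds) x = begin
  hornerWith mulζ cs (d · x ⊕ mulζ (hornerWith mulζ ds x))
    ≡⟨ Mulζ.hornerWith-⊕ʳ cs _ _ ⟩
  hornerWith mulζ cs (d · x) ⊕ hornerWith mulζ cs (mulζ (hornerWith mulζ ds x))
    ≡⟨ cong₂ _⊕_ (Mulζ.hornerWith-·ʳ cs d x) (trans (Mulζ.hornerWith-f cs _) (cong mulζ (hornerWith-mulζ-swap cs ds x))) ⟩
  d · hornerWith mulζ cs x ⊕ mulζ (hornerWith mulζ ds (hornerWith mulζ cs x)) ∎
  where open ≡-Reasoning

⊛-comm : ∀ {n} (a b : Vec ℤ n) → a ⊛ b ≡ b ⊛ a
⊛-comm a b = begin
  a ⊛ b                                                   ≡⟨ ⊛≡hornerWith a b ⟩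
  hornerWith mulζ (toList a) b                            ≡⟨ cong (hornerWith mulζ (toList a)) (sym (as-hornerWith b)) ⟩
  hornerWith mulζ (toList a) (hornerWith mulζ (toList b) 1c) ≡⟨ hornerWith-mulζ-swap (toList a) (toList b) 1c ⟩
  hornerWith mulζ (toList b) (hornerWith mulζ (toList a) 1c) ≡⟨ cong (hornerWith mulζ (toList b)) (as-hornerWith a) ⟩
  hornerWith mulζ (toList b) a                            ≡⟨ sym (⊛≡hornerWith b a) ⟩
  b ⊛ a                                                   ∎
  where
  open ≡-Reasoning
  as-hornerWith : ∀ c → hornerWith mulζ (toList c) 1c ≡ c
  as-hornerWith c = trans (sym (⊛≡hornerWith c 1c)) (⊛-identityʳ c)

-- Powers of ζ

ζ^-suc : ∀ {n} k → ζ^ {n} (k + + 1) ≡ mulζ (ζ^ k)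
ζ^-suc (+ k)            = cong (λ m → ζ^ (+ m)) (ℕP.+-comm k 1)
ζ^-suc -[1+ zero ]      = sym (mulζ∘mulζ⁻¹ 1c)
ζ^-suc -[1+ suc m ]     = sym (mulζ∘mulζ⁻¹ _)

ζ^-+ℕ : ∀ {n} k m → ζ^ {n} (k + + m) ≡ iter m mulζ (ζ^ k)
ζ^-+ℕ k zero    = cong ζ^ (ℤP.+-identityʳ k)
ζ^-+ℕ k (suc m) = begin
  ζ^ (k + (+ 1 + + m))   ≡⟨ cong ζ^ (shift k (+ m)) ⟩
  ζ^ ((k + + m) + + 1)   ≡⟨ ζ^-suc (k + + m) ⟩
  mulζ (ζ^ (k + + m))    ≡⟨ cong mulζ (ζ^-+ℕ k m) ⟩
  mulζ (iter m mulζ (ζ^ k)) ∎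
  where
  open ≡-Reasoning
  shift : ∀ k m → k + (+ 1 + m) ≡ (k + m) + + 1
  shift = solve-∀

ζ^-pred : ∀ {n} k → ζ^ {n} (k - + 1) ≡ mulζ⁻¹ (ζ^ k)
ζ^-pred k = begin
  ζ^ (k - + 1)                    ≡⟨ sym (mulζ⁻¹∘mulζ _) ⟩
  mulζ⁻¹ (mulζ (ζ^ (k - + 1)))    ≡⟨ cong mulζ⁻¹ (sym (ζ^-suc (k - + 1))) ⟩
  mulζ⁻¹ (ζ^ ((k - + 1) + + 1))   ≡⟨ cong (λ z → mulζ⁻¹ (ζ^ z)) (cancel k) ⟩
  mulζ⁻¹ (ζ^ k)                   ∎
  where
  open ≡-Reasoning
  cancel : ∀ k → (k - + 1) + + 1 ≡ k
  cancel = solve-∀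

ζ^-∸ℕ : ∀ {n} k m → ζ^ {n} (k - + m) ≡ iter m mulζ⁻¹ (ζ^ k)
ζ^-∸ℕ k zero    = cong ζ^ (ℤP.+-identityʳ k)
ζ^-∸ℕ k (suc m) = begin
  ζ^ (k - (+ 1 + + m))         ≡⟨ cong ζ^ (shift k (+ m)) ⟩
  ζ^ ((k - + m) - + 1)         ≡⟨ ζ^-pred (k - + m) ⟩
  mulζ⁻¹ (ζ^ (k - + m))        ≡⟨ cong mulζ⁻¹ (ζ^-∸ℕ k m) ⟩
  mulζ⁻¹ (iter m mulζ⁻¹ (ζ^ k)) ∎
  where
  open ≡-Reasoning
  shift : ∀ k m → k - (+ 1 + m) ≡ (k - m) - + 1
  shift = solve-∀

ζ^-+ : ∀ {n} a b → ζ^ {n} (a + b) ≡ ζ^ a ⊛ ζ^ b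
ζ^-+ a (+ m) = begin
  ζ^ (a + + m)                 ≡⟨ ζ^-+ℕ a m ⟩
  iter m mulζ (ζ^ a)           ≡⟨ cong (iter m mulζ) (sym (⊛-identityʳ (ζ^ a))) ⟩
  iter m mulζ (ζ^ a ⊛ 1c)      ≡⟨ iter-commute m mulζ (ζ^ a ⊛_) (λ b → sym (⊛-mulζ (ζ^ a) b)) 1c ⟩
  ζ^ a ⊛ iter m mulζ 1c        ∎
  where open ≡-Reasoning
ζ^-+ a -[1+ m ] = begin
  ζ^ (a - + suc m)                     ≡⟨ ζ^-∸ℕ a (suc m) ⟩
  iter (suc m) mulζ⁻¹ (ζ^ a)           ≡⟨ cong (iter (suc m) mulζ⁻¹) (sym (⊛-identityʳ (ζ^ a))) ⟩
  iter (suc m) mulζ⁻¹ (ζ^ a ⊛ 1c)      ≡⟨ iter-commute (suc m) mulζ⁻¹ (ζ^ a ⊛_) (λ b → sym (⊛-mulζ⁻¹ (ζ^ a) b)) 1c ⟩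
  ζ^ a ⊛ iter (suc m) mulζ⁻¹ 1c        ∎
  where open ≡-Reasoning

ζ^-half : ∀ {n} → ζ^ {n} (+ n) ≡ ⊖ 1c
ζ^-half = iter-mulζ-n 1c

ζ^-multiple-2n : ∀ {n} t → ζ^ {n} (+ (n ℕ.+ n) * t) ≡ 1c
ζ^-multiple-2n {n} (+ m) = trans (cong ζ^ (sym (ℤP.pos-* (n ℕ.+ n) m))) (iter-multiple m)
  where
  iter-multiple : ∀ m → iter ((n ℕ.+ n) ℕ.* m) mulζ 1c ≡ 1c
  iter-multiple zero    = cong (λ k → iter k mulζ 1c) (ℕP.*-zeroʳ (n ℕ.+ n))
  iter-multiple (suc m) = begin
    iter ((n ℕ.+ n) ℕ.* suc m) mulζ 1c            ≡⟨ cong (λ k → iter k mulζ 1c) (ℕP.*-suc (n ℕ.+ n) m) ⟩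
    iter ((n ℕ.+ n) ℕ.+ (n ℕ.+ n) ℕ.* m) mulζ 1c   ≡⟨ iter-+ (n ℕ.+ n) _ mulζ 1c ⟩
    iter (n ℕ.+ n) mulζ (iter ((n ℕ.+ n) ℕ.* m) mulζ 1c) ≡⟨ cong (iter (n ℕ.+ n) mulζ) (iter-multiple m) ⟩
    iter (n ℕ.+ n) mulζ 1c                        ≡⟨ iter-mulζ-2n 1c ⟩
    1c                                            ∎
    where open ≡-Reasoning
ζ^-multiple-2n {n} -[1+ m ] = begin
  ζ^ (N * - (+ suc m))                    ≡⟨ cong ζ^ (sym (ℤP.neg-distribʳ-* N (+ suc m))) ⟩
  ζ^ (- (N * + suc m))                    ≡⟨ sym (⊛-identityʳ _) ⟩
  ζ^ (- (N * + suc m)) ⊛ 1c               ≡⟨ cong (ζ^ (- (N * + suc m)) ⊛_) (sym (ζ^-multiple-2n (+ suc m))) ⟩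
  ζ^ (- (N * + suc m)) ⊛ ζ^ (N * + suc m) ≡⟨ sym (ζ^-+ (- (N * + suc m)) (N * + suc m)) ⟩
  ζ^ (- (N * + suc m) + N * + suc m)      ≡⟨ cong ζ^ (ℤP.+-inverseˡ (N * + suc m)) ⟩
  1c                                      ∎
  where
  open ≡-Reasoning
  N = + (n ℕ.+ n)

ζ^-periodic : ∀ {n} a t → ζ^ {n} (a + + (n ℕ.+ n) * t) ≡ ζ^ a
ζ^-periodic {n} a t = begin
  ζ^ (a + + (n ℕ.+ n) * t)       ≡⟨ ζ^-+ a _ ⟩
  ζ^ a ⊛ ζ^ (+ (n ℕ.+ n) * t)    ≡⟨ cong (ζ^ a ⊛_) (ζ^-multiple-2n t) ⟩
  ζ^ a ⊛ 1c                      ≡⟨ ⊛-identityʳ (ζ^ a) ⟩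
  ζ^ a                           ∎
  where open ≡-Reasoning

ζ^-negℕ : ∀ {n} i → ζ^ {n} (- (+ i)) ≡ iter i mulζ⁻¹ 1c
ζ^-negℕ zero    = refl
ζ^-negℕ (suc i) = refl

conj≡hornerWith : ∀ {n} (a : Vec ℤ n) → conj a ≡ hornerWith mulζ⁻¹ (toList a) 1c
conj≡hornerWith {n} a = conjAux≡ 0 (toList a)
  where
  conjAux≡ : ∀ i cs → conjAux {n} i cs ≡ hornerWith mulζ⁻¹ cs (iter i mulζ⁻¹ 1c)
  conjAux≡ i []ᴸ       = refl
  conjAux≡ i (c ∷ᴸ cs) =
    cong₂ _⊕_ (cong (c ·_) (ζ^-negℕ i)) (trans (conjAux≡ (suc i) cs) (Mulζ⁻¹.hornerWith-f cs _))

conj-mulζ : ∀ {n} (a : Vec ℤ n) → conj (mulζ a) ≡ mulζ⁻¹ (conj a)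
conj-mulζ a = begin
  conj (mulζ a)                                  ≡⟨ conj≡hornerWith (mulζ a) ⟩
  hornerWith mulζ⁻¹ (toList (mulζ a)) 1c         ≡⟨ Mulζ⁻¹.hornerWith-mulζˡ iter-mulζ⁻¹-n a 1c ⟩
  mulζ⁻¹ (hornerWith mulζ⁻¹ (toList a) 1c)       ≡⟨ cong mulζ⁻¹ (sym (conj≡hornerWith a)) ⟩
  mulζ⁻¹ (conj a)                                ∎
  where open ≡-Reasoning

conj-mulζ⁻¹ : ∀ {n} (a : Vec ℤ n) → conj (mulζ⁻¹ a) ≡ mulζ (conj a)
conj-mulζ⁻¹ a = begin
  conj (mulζ⁻¹ a)                        ≡⟨ sym (mulζ∘mulζ⁻¹ _) ⟩
  mulζ (mulζ⁻¹ (conj (mulζ⁻¹ a)))        ≡⟨ cong mulζ (sym (conj-mulζ (mulζ⁻¹ a))) ⟩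
  mulζ (conj (mulζ (mulζ⁻¹ a)))          ≡⟨ cong (λ z → mulζ (conj z)) (mulζ∘mulζ⁻¹ a) ⟩
  mulζ (conj a)                          ∎
  where open ≡-Reasoning

conj-1c : ∀ {n} → conj (1c {n}) ≡ 1c
conj-1c {zero}  = refl
conj-1c {suc n} = begin
  conj 1c                                                       ≡⟨ conj≡hornerWith 1c ⟩
  (+ 1) · 1c ⊕ mulζ⁻¹ (hornerWith mulζ⁻¹ (toList (0c {n})) 1c) ≡⟨ cong (λ z → (+ 1) · 1c ⊕ mulζ⁻¹ z) (Mulζ⁻¹.hornerWith-0cˡ {suc n} {n} 1c) ⟩
  (+ 1) · 1c ⊕ mulζ⁻¹ 0c                                        ≡⟨ cong₂ _⊕_ (·-identityˡ 1c) Mulζ⁻¹.f-0c ⟩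
  1c ⊕ 0c                                                       ≡⟨ ⊕-identityʳ 1c ⟩
  1c                                                            ∎
  where open ≡-Reasoning

conj-ζ^ : ∀ {n} k → conj (ζ^ {n} k) ≡ ζ^ (- k)
conj-ζ^ {n} (+ k)     = trans (conj-iter-mulζ k) (sym (ζ^-negℕ k))
  where
  conj-iter-mulζ : ∀ k → conj (iter k mulζ (1c {n})) ≡ iter k mulζ⁻¹ 1c
  conj-iter-mulζ zero    = conj-1c
  conj-iter-mulζ (suc k) = trans (conj-mulζ (iter k mulζ 1c)) (cong mulζ⁻¹ (conj-iter-mulζ k))
conj-ζ^ {n} -[1+ k ] = conj-iter-mulζ⁻¹ (suc k)
  where
  conj-iter-mulζ⁻¹ : ∀ k → conj (iter k mulζ⁻¹ (1c {n})) ≡ iter k mulζ 1c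
  conj-iter-mulζ⁻¹ zero    = conj-1c
  conj-iter-mulζ⁻¹ (suc k) = trans (conj-mulζ⁻¹ (iter k mulζ⁻¹ 1c)) (cong mulζ (conj-iter-mulζ⁻¹ k))

ζ^-^ᶻ : ∀ {n} e k → (ζ^ {n} e) ^ᶻ k ≡ ζ^ (e * k)
ζ^-^ᶻ e (+ k)     = powℕ e k
  where
  powℕ : ∀ e k → iter k (ζ^ e ⊛_) 1c ≡ ζ^ (e * + k)
  powℕ e zero    = sym (cong ζ^ (ℤP.*-zeroʳ e))
  powℕ e (suc k) = begin
    ζ^ e ⊛ iter k (ζ^ e ⊛_) 1c   ≡⟨ cong (ζ^ e ⊛_) (powℕ e k) ⟩
    ζ^ e ⊛ ζ^ (e * + k)          ≡⟨ sym (ζ^-+ e _) ⟩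
    ζ^ (e + e * + k)             ≡⟨ cong ζ^ (distrib e (+ k)) ⟩
    ζ^ (e * (+ 1 + + k))         ∎
    where
    open ≡-Reasoning
    distrib : ∀ e k → e + e * k ≡ e * (+ 1 + k)
    distrib = solve-∀
ζ^-^ᶻ e -[1+ k ] = begin
  iter (suc k) (conj (ζ^ e) ⊛_) 1c   ≡⟨ cong (λ z → iter (suc k) (z ⊛_) 1c) (conj-ζ^ e) ⟩
  (ζ^ (- e)) ^ᶻ (+ suc k)            ≡⟨ ζ^-^ᶻ (- e) (+ suc k) ⟩
  ζ^ (- e * + suc k)                 ≡⟨ cong ζ^ (sym (ℤP.neg-distribˡ-* e (+ suc k))) ⟩
  ζ^ (- (e * + suc k))               ≡⟨ cong ζ^ (ℤP.neg-distribʳ-* e (+ suc k)) ⟩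
  ζ^ (e * -[1+ k ])                  ∎
  where open ≡-Reasoning

-- Finite sums

sumTo-cong : ∀ {n} k {f g : ℕ → Vec ℤ n} → (∀ i → i < k → f i ≡ g i) → sumTo k f ≡ sumTo k g
sumTo-cong zero    f≡g = refl
sumTo-cong (suc k) f≡g = cong₂ _⊕_ (sumTo-cong k (λ i i<k → f≡g i (ℕP.m≤n⇒m≤1+n i<k))) (f≡g k ℕP.≤-refl)

sumTo-zero : ∀ {n} k (f : ℕ → Vec ℤ n) → (∀ i → i < k → f i ≡ 0c) → sumTo k f ≡ 0c
sumTo-zero k f f≡0 = trans (sumTo-cong k f≡0) (zeros k)
  where
  zeros : ∀ k → sumTo k (λ _ → 0c) ≡ 0c
  zeros zero    = refl
  zeros (suc k) = trans (cong (_⊕ 0c) (zeros k)) (⊕-identityˡ 0c)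

sumTo-⊕ : ∀ {n} k (f g : ℕ → Vec ℤ n) → sumTo k (λ i → f i ⊕ g i) ≡ sumTo k f ⊕ sumTo k g
sumTo-⊕ zero    f g = sym (⊕-identityˡ 0c)
sumTo-⊕ (suc k) f g = trans (cong (_⊕ (f k ⊕ g k)) (sumTo-⊕ k f g)) (⊕-interchange _ _ _ _)

sumTo-+ : ∀ {n} a b (f : ℕ → Vec ℤ n) → sumTo (a ℕ.+ b) f ≡ sumTo a f ⊕ sumTo b (λ i → f (a ℕ.+ i))
sumTo-+ a zero    f = trans (cong (λ k → sumTo k f) (ℕP.+-identityʳ a)) (sym (⊕-identityʳ _))
sumTo-+ a (suc b) f = begin
  sumTo (a ℕ.+ suc b) f                                  ≡⟨ cong (λ k → sumTo k f) (ℕP.+-suc a b) ⟩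
  sumTo (a ℕ.+ b) f ⊕ f (a ℕ.+ b)                        ≡⟨ cong (_⊕ f (a ℕ.+ b)) (sumTo-+ a b f) ⟩
  (sumTo a f ⊕ sumTo b (λ i → f (a ℕ.+ i))) ⊕ f (a ℕ.+ b) ≡⟨ ⊕-assoc _ _ _ ⟩
  sumTo a f ⊕ sumTo (suc b) (λ i → f (a ℕ.+ i))          ∎
  where open ≡-Reasoning

sumTo-⊛ : ∀ {n} k (x : Vec ℤ n) (f : ℕ → Vec ℤ n) → sumTo k (λ i → x ⊛ f i) ≡ x ⊛ sumTo k f
sumTo-⊛ zero    x f = sym (⊛-zeroʳ x)
sumTo-⊛ (suc k) x f = trans (cong (_⊕ (x ⊛ f k)) (sumTo-⊛ k x f)) (sym (⊛-distribˡ x _ _))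

sumTo-const : ∀ {n} k (x : Vec ℤ n) → sumTo k (λ _ → x) ≡ (+ k) · x
sumTo-const zero    x = sym (·-zeroˡ x)
sumTo-const (suc k) x = begin
  sumTo k (λ _ → x) ⊕ x    ≡⟨ cong₂ _⊕_ (sumTo-const k x) (sym (·-identityˡ x)) ⟩
  (+ k) · x ⊕ (+ 1) · x    ≡⟨ sym (·-distribʳ-+ (+ k) (+ 1) x) ⟩
  (+ k + + 1) · x          ≡⟨ cong (_· x) (ℤP.+-comm (+ k) (+ 1)) ⟩
  (+ suc k) · x            ∎
  where open ≡-Reasoning

sumTo-* : ∀ {n} B M (f : ℕ → Vec ℤ n) → sumTo (B ℕ.* M) f ≡ sumTo B (λ h → sumTo M (λ y → f (h ℕ.+ B ℕ.* y)))
sumTo-* B zero    f = trans (cong (λ k → sumTo k f) (ℕP.*-zeroʳ B)) (sym (sumTo-zero B _ (λ _ _ → refl)))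
sumTo-* B (suc M) f = begin
  sumTo (B ℕ.* suc M) f                                     ≡⟨ cong (λ k → sumTo k f) (trans (ℕP.*-suc B M) (ℕP.+-comm B (B ℕ.* M))) ⟩
  sumTo (B ℕ.* M ℕ.+ B) f                                   ≡⟨ sumTo-+ (B ℕ.* M) B f ⟩
  sumTo (B ℕ.* M) f ⊕ sumTo B (λ i → f (B ℕ.* M ℕ.+ i))     ≡⟨ cong₂ _⊕_ (sumTo-* B M f) (sumTo-cong B (λ i _ → cong f (ℕP.+-comm (B ℕ.* M) i))) ⟩
  sumTo B (λ h → sumTo M (λ y → f (h ℕ.+ B ℕ.* y))) ⊕ sumTo B (λ h → f (h ℕ.+ B ℕ.* M)) ≡⟨ sym (sumTo-⊕ B _ _) ⟩
  sumTo B (λ h → sumTo (suc M) (λ y → f (h ℕ.+ B ℕ.* y)))   ∎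
  where open ≡-Reasoning

sumTo-single : ∀ {n} k (f : ℕ → Vec ℤ n) p → p < k → (∀ i → i < k → i ≢ p → f i ≡ 0c) → sumTo k f ≡ f p
sumTo-single (suc k) f p p<1+k others with p ℕ.≟ k
... | yes refl = trans (cong (_⊕ f p) (sumTo-zero k f (λ i i<k → others i (ℕP.m≤n⇒m≤1+n i<k) (λ i≡k → ℕP.<-irrefl i≡k i<k)))) (⊕-identityˡ _)
... | no p≢k   = trans (cong₂ _⊕_ (sumTo-single k f p p<k (λ i i<k → others i (ℕP.m≤n⇒m≤1+n i<k))) (others k ℕP.≤-refl (p≢k ∘ sym))) (⊕-identityʳ _)
  where p<k = ℕP.≤∧≢⇒< (ℕP.≤-pred p<1+k) p≢k

-- 2-adic arithmetic

2∤1 : ¬ (+ 2 ∣ + 1)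
2∤1 2∣1 with ℕD.∣1⇒≡1 (ℤD.∣⇒∣ᵤ 2∣1)
... | ()

odd⇒2∤ : ∀ {z} → OddZ z → ¬ (+ 2 ∣ z)
odd⇒2∤ (k , refl) 2∣z = 2∤1 (subst (+ 2 ∣_) (cancel k) (ℤD.∣m∣n⇒∣m-n 2∣z (divides k (ℤP.*-comm (+ 2) k))))
  where
  cancel : ∀ k → (+ 1 + + 2 * k) - + 2 * k ≡ + 1
  cancel = solve-∀

parity : ∀ z → (+ 2 ∣ z) ⊎ OddZ z
parity z with z %ℕ 2 | n%ℕd<d z 2 | a≡a%ℕn+[a/ℕn]*n z 2
... | zero        | _               | z≡ = inj₁ (divides (z /ℕ 2) (trans z≡ (ℤP.+-identityˡ _)))
... | suc zero    | _               | z≡ = inj₂ (z /ℕ 2 , trans z≡ (cong (λ w → + 1 + w) (ℤP.*-comm (z /ℕ 2) (+ 2))))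
... | suc (suc _) | s≤s (s≤s ())    | _

odd-+-even : ∀ {a} b → OddZ a → OddZ (a + + 2 * b)
odd-+-even b (k , refl) = k + b , regroup k b
  where
  regroup : ∀ k b → + 1 + + 2 * k + + 2 * b ≡ + 1 + + 2 * (k + b)
  regroup = solve-∀

odd-* : ∀ {a b} → OddZ a → OddZ b → OddZ (a * b)
odd-* (k , refl) (l , refl) = k + l + + 2 * k * l , expand k l
  where
  expand : ∀ k l → (+ 1 + + 2 * k) * (+ 1 + + 2 * l) ≡ + 1 + + 2 * (k + l + + 2 * k * l)
  expand = solve-∀

2^suc : ∀ k → + (2 ^ suc k) ≡ + 2 * + (2 ^ k)
2^suc k = ℤP.pos-* 2 (2 ^ k)

pos-+-* : ∀ a b c → + (a ℕ.+ b ℕ.* c) ≡ + a + + b * + c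
pos-+-* a b c = trans (ℤP.pos-+ a (b ℕ.* c)) (cong (λ z → + a + z) (ℤP.pos-* b c))

pos-2^+ : ∀ m k → + (2 ^ (m ℕ.+ k)) ≡ + (2 ^ m) * + (2 ^ k)
pos-2^+ m k = trans (cong +_ (ℕP.^-distribˡ-+-* 2 m k)) (ℤP.pos-* (2 ^ m) (2 ^ k))

2^∣odd*⇒2^∣ : ∀ k {o z} → OddZ o → + (2 ^ k) ∣ o * z → + (2 ^ k) ∣ z
2^∣odd*⇒2^∣ zero    {o} {z} _     _ = divides z (sym (ℤP.*-identityʳ z))
2^∣odd*⇒2^∣ (suc k) {o} {z} odd-o 2^k+1∣oz with parity z
... | inj₂ odd-z = ⊥-elim (odd⇒2∤ (odd-* odd-o odd-z) (ℤD.∣-trans 2∣2^k+1 2^k+1∣oz))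
  where
  2∣2^k+1 : + 2 ∣ + (2 ^ suc k)
  2∣2^k+1 = divides (+ (2 ^ k)) (trans (2^suc k) (ℤP.*-comm (+ 2) (+ (2 ^ k))))
... | inj₁ (divides z′ refl) =
  subst₂ _∣_ (sym (2^suc k)) (ℤP.*-comm (+ 2) z′) (ℤD.*-monoʳ-∣ (+ 2) (2^∣odd*⇒2^∣ k odd-o 2^k∣oz′))
  where
  halve : ∀ o z′ → o * (z′ * + 2) ≡ + 2 * (o * z′)
  halve = solve-∀
  2^k∣oz′ : + (2 ^ k) ∣ o * z′
  2^k∣oz′ = ℤD.*-cancelˡ-∣ (+ 2) (subst₂ _∣_ (2^suc k) (halve o z′) 2^k+1∣oz)

odd⇒coprime-2 : ∀ {d} → ¬ (2 ℕD.∣ d) → Coprime d 2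
odd⇒coprime-2 2∤d {zero}              (_   , 0∣2) with ℕD.0∣⇒≡0 0∣2
... | ()
odd⇒coprime-2 2∤d {suc zero}          _         = refl
odd⇒coprime-2 2∤d {suc (suc zero)}    (2∣d , _) = ⊥-elim (2∤d 2∣d)
odd⇒coprime-2 2∤d {suc (suc (suc _))} (_ , e∣2) with ℕD.∣⇒≤ e∣2
... | s≤s (s≤s ())

gcd-odd-2^ : ∀ a {z} → OddZ z → gcd ℤ.∣ z ∣ (2 ^ a) ≡ 1
gcd-odd-2^ a {z} odd-z =
  odd∣2^⇒≡1 a (λ 2∣g → odd⇒2∤ odd-z (ℤD.∣ᵤ⇒∣ (ℕD.∣-trans 2∣g (gcd[m,n]∣m ℤ.∣ z ∣ (2 ^ a))))) (gcd[m,n]∣n ℤ.∣ z ∣ (2 ^ a))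
  where
  odd∣2^⇒≡1 : ∀ a {d} → ¬ (2 ℕD.∣ d) → d ℕD.∣ 2 ^ a → d ≡ 1
  odd∣2^⇒≡1 zero    2∤d d∣1 = ℕD.∣1⇒≡1 d∣1
  odd∣2^⇒≡1 (suc a) 2∤d d∣2^a+1 = odd∣2^⇒≡1 a 2∤d (coprime-divisor (odd⇒coprime-2 2∤d) d∣2^a+1)

gcd-even-2^ : ∀ a h → 2 ℕD.∣ h → gcd h (2 ^ suc a) ≢ 1
gcd-even-2^ a h 2∣h gcd≡1 = 2∤1 (ℤD.∣ᵤ⇒∣ (subst (2 ℕD.∣_) gcd≡1 (gcd-greatest 2∣h (ℕD.divides (2 ^ a) (ℕP.*-comm 2 (2 ^ a))))))

-- Geometric sums of roots of unity

sumTo-2* : ∀ {n} k (f : ℕ → Vec ℤ n) → sumTo (2 ℕ.* k) f ≡ sumTo k (λ y → f y ⊕ f (k ℕ.+ y))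
sumTo-2* k f = begin
  sumTo (k ℕ.+ (k ℕ.+ 0)) f                  ≡⟨ cong (λ m → sumTo (k ℕ.+ m) f) (ℕP.+-identityʳ k) ⟩
  sumTo (k ℕ.+ k) f                          ≡⟨ sumTo-+ k k f ⟩
  sumTo k f ⊕ sumTo k (λ y → f (k ℕ.+ y))    ≡⟨ sym (sumTo-⊕ k f _) ⟩
  sumTo k (λ y → f y ⊕ f (k ℕ.+ y))          ∎
  where open ≡-Reasoning

geometricSum-halves : ∀ {n} k j c → 2 ^ (j ℕ.+ suc k) ≡ n ℕ.+ n →
                      sumTo (2 ^ suc k) (λ y → ζ^ {n} (+ (2 ^ j) * c * + y)) ≡
                      sumTo (2 ^ k) (λ y → ζ^ (+ (2 ^ j) * c * + y) ⊕ ζ^ (+ (2 ^ j) * c * + y) ⊛ ζ^ (+ n * c))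
geometricSum-halves {n} k j c 2^j+k+1≡2n =
  trans (sumTo-2* (2 ^ k) f) (sumTo-cong (2 ^ k) (λ y _ → cong (f y ⊕_) (trans (cong ζ^ (exponent y)) (ζ^-+ (+ (2 ^ j) * c * + y) (+ n * c)))))
  where
  f : ℕ → Vec ℤ n
  f y = ζ^ (+ (2 ^ j) * c * + y)
  2^j*2^k≡n : + (2 ^ j) * + (2 ^ k) ≡ + n
  2^j*2^k≡n = trans (sym (ℤP.pos-* (2 ^ j) (2 ^ k))) (cong +_ (ℕP.*-cancelˡ-≡ _ _ 2 (begin
    2 ℕ.* (2 ^ j ℕ.* 2 ^ k)  ≡⟨ cong (2 ℕ.*_) (sym (ℕP.^-distribˡ-+-* 2 j k)) ⟩
    2 ^ suc (j ℕ.+ k)        ≡⟨ cong (2 ^_) (sym (ℕP.+-suc j k)) ⟩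
    2 ^ (j ℕ.+ suc k)        ≡⟨ 2^j+k+1≡2n ⟩
    n ℕ.+ n                  ≡⟨ cong (n ℕ.+_) (sym (ℕP.+-identityʳ n)) ⟩
    2 ℕ.* n                  ∎)))
    where open ≡-Reasoning
  split : ∀ a c p y n → a * p ≡ n → a * c * (p + y) ≡ a * c * y + n * c
  split a c p y n refl = distrib a c p y
    where
    distrib : ∀ a c p y → a * c * (p + y) ≡ a * c * y + a * p * c
    distrib = solve-∀
  exponent : ∀ y → + (2 ^ j) * c * + (2 ^ k ℕ.+ y) ≡ + (2 ^ j) * c * + y + + n * c
  exponent y = split (+ (2 ^ j)) c (+ (2 ^ k)) (+ y) (+ n) 2^j*2^k≡n

-- ζ^(2^j) is a primitive 2^k-th root of unity when 2^(j+k) = 2n.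
geometricSum-∤ : ∀ {n} k j c → 2 ^ (j ℕ.+ k) ≡ n ℕ.+ n → ¬ (+ (2 ^ k) ∣ c) →
                 sumTo (2 ^ k) (λ y → ζ^ {n} (+ (2 ^ j) * c * + y)) ≡ 0c
geometricSum-∤       zero    j c _         1∤c = ⊥-elim (1∤c (divides c (sym (ℤP.*-identityʳ c))))
geometricSum-∤ {n} (suc k) j c 2^j+k+1≡2n 2^k+1∤c =
  trans (geometricSum-halves k j c 2^j+k+1≡2n) (pairs (parity c))
  where
  f : ℕ → Vec ℤ n
  f y = ζ^ (+ (2 ^ j) * c * + y)
  pairs : (+ 2 ∣ c) ⊎ OddZ c → sumTo (2 ^ k) (λ y → f y ⊕ f y ⊛ ζ^ (+ n * c)) ≡ 0c
  pairs (inj₂ (e , refl)) = sumTo-zero (2 ^ k) _ (λ y _ → begin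
    f y ⊕ f y ⊛ ζ^ (+ n * (+ 1 + + 2 * e))  ≡⟨ cong (λ z → f y ⊕ f y ⊛ z) (trans (cong ζ^ (odd-multiple (+ n) e)) (trans (ζ^-periodic (+ n) e) ζ^-half)) ⟩
    f y ⊕ f y ⊛ ⊖ 1c                        ≡⟨ cong (f y ⊕_) (trans (⊛-⊖ (f y) 1c) (cong ⊖_ (⊛-identityʳ (f y)))) ⟩
    f y ⊕ ⊖ f y                             ≡⟨ ⊕-inverseʳ (f y) ⟩
    0c                                      ∎)
    where
    open ≡-Reasoning
    odd-multiple : ∀ n e → n * (+ 1 + + 2 * e) ≡ n + (n + n) * e
    odd-multiple = solve-∀
  pairs (inj₁ (divides c′ refl)) = begin
    sumTo (2 ^ k) (λ y → f y ⊕ f y ⊛ ζ^ (+ n * (c′ * + 2)))  ≡⟨ sumTo-cong (2 ^ k) (λ y _ → cong (λ z → f y ⊕ f y ⊛ z) full-turn) ⟩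
    sumTo (2 ^ k) (λ y → f y ⊕ f y ⊛ 1c)                     ≡⟨ sumTo-⊕ (2 ^ k) f _ ⟩
    sumTo (2 ^ k) f ⊕ sumTo (2 ^ k) (λ y → f y ⊛ 1c)         ≡⟨ cong₂ _⊕_ half-sum (trans (sumTo-cong (2 ^ k) (λ y _ → ⊛-identityʳ (f y))) half-sum) ⟩
    0c ⊕ 0c                                                   ≡⟨ ⊕-identityˡ 0c ⟩
    0c                                                        ∎
    where
    open ≡-Reasoning
    even-multiple : ∀ n c′ → n * (c′ * + 2) ≡ (n + n) * c′
    even-multiple = solve-∀
    full-turn : ζ^ {n} (+ n * (c′ * + 2)) ≡ 1c
    full-turn = trans (cong ζ^ (even-multiple (+ n) c′)) (ζ^-multiple-2n c′)
    regroup : ∀ a c′ y → a * (c′ * + 2) * y ≡ (+ 2 * a) * c′ * y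
    regroup = solve-∀
    2^k∤c′ : ¬ (+ (2 ^ k) ∣ c′)
    2^k∤c′ 2^k∣c′ = 2^k+1∤c (subst₂ _∣_ (sym (2^suc k)) (ℤP.*-comm (+ 2) c′) (ℤD.*-monoʳ-∣ (+ 2) 2^k∣c′))
    half-sum : sumTo (2 ^ k) f ≡ 0c
    half-sum = trans (sumTo-cong (2 ^ k) (λ y _ → cong ζ^ (trans (regroup (+ (2 ^ j)) c′ (+ y)) (cong (λ z → z * c′ * + y) (sym (2^suc j))))))
                     (geometricSum-∤ k (suc j) c′ (trans (cong (2 ^_) (sym (ℕP.+-suc j k))) 2^j+k+1≡2n) 2^k∤c′)

geometricSum-∣ : ∀ {n} k j c → 2 ^ (j ℕ.+ k) ≡ n ℕ.+ n → + (2 ^ k) ∣ c →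
                 sumTo (2 ^ k) (λ y → ζ^ {n} (+ (2 ^ j) * c * + y)) ≡ (+ (2 ^ k)) · 1c
geometricSum-∣ {n} k j c 2^j+k≡2n (divides d refl) =
  trans (sumTo-cong (2 ^ k) (λ y _ → trans (cong ζ^ (full-turns (+ (2 ^ j)) d (+ (2 ^ k)) (+ y) _ 2^j*2^k≡2n)) (ζ^-periodic (+ 0) (d * + y))))
        (sumTo-const (2 ^ k) 1c)
  where
  2^j*2^k≡2n : + (2 ^ j) * + (2 ^ k) ≡ + (n ℕ.+ n)
  2^j*2^k≡2n = trans (sym (ℤP.pos-* (2 ^ j) (2 ^ k))) (cong +_ (trans (sym (ℕP.^-distribˡ-+-* 2 j k)) 2^j+k≡2n))
  full-turns : ∀ a d p y N → a * p ≡ N → a * (d * p) * y ≡ + 0 + N * (d * y)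
  full-turns a d p y N refl = regroup a d p y
    where
    regroup : ∀ a d p y → a * (d * p) * y ≡ + 0 + (a * p) * (d * y)
    regroup = solve-∀

innerSum : ∀ {n} (q : ℕ) (χ : ℤ → Vec ℤ n) (u : ℤ) (h : ℕ) → Vec ℤ n
innerSum q χ u h = sumTo q λ g → if isInvPair q h g then χ (+ h) ⊛ ζ^ (u * + h + u * + g) else 0c

isInvPair-true : ∀ q h g → gcd h q ≡ 1 → q ℕD.∣ ℤ.∣ + h * + g - + 1 ∣ → isInvPair q h g ≡ true
isInvPair-true q h g gcd≡1 q∣hg-1 with gcd h q ℕ.≟ 1 | q ℕD.∣? ℤ.∣ + h * + g - + 1 ∣
... | yes _    | yes _    = refl
... | yes _    | no  q∤hg-1 = ⊥-elim (q∤hg-1 q∣hg-1)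
... | no gcd≢1 | _        = ⊥-elim (gcd≢1 gcd≡1)

isInvPair-not-coprime : ∀ q h g → gcd h q ≢ 1 → isInvPair q h g ≡ false
isInvPair-not-coprime q h g gcd≢1 with gcd h q ℕ.≟ 1
... | yes gcd≡1 = ⊥-elim (gcd≢1 gcd≡1)
... | no _      = refl

isInvPair-not-inverse : ∀ q h g → ¬ (q ℕD.∣ ℤ.∣ + h * + g - + 1 ∣) → isInvPair q h g ≡ false
isInvPair-not-inverse q h g q∤hg-1 with gcd h q ℕ.≟ 1 | q ℕD.∣? ℤ.∣ + h * + g - + 1 ∣
... | yes _ | yes q∣hg-1 = ⊥-elim (q∤hg-1 q∣hg-1)
... | yes _ | no _       = refl
... | no _  | _          = refl

if-true : ∀ {A : Set} {b : Bool} {x y : A} → b ≡ true → (if b then x else y) ≡ x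
if-true refl = refl

if-false : ∀ {A : Set} {b : Bool} {x y : A} → b ≡ false → (if b then x else y) ≡ y
if-false refl = refl

innerSum-even : ∀ {n} a (χ : ℤ → Vec ℤ n) u h → 2 ℕD.∣ h → innerSum (2 ^ suc a) χ u h ≡ 0c
innerSum-even a χ u h 2∣h =
  sumTo-zero (2 ^ suc a) _ (λ g _ → if-false (isInvPair-not-coprime (2 ^ suc a) h g (gcd-even-2^ a h 2∣h)))

∣∧<⇒≡0 : ∀ {q m} → q ℕD.∣ m → m < q → m ≡ 0
∣∧<⇒≡0 {m = zero}  _   _   = refl
∣∧<⇒≡0 {m = suc m} q∣m m<q = ⊥-elim (ℕP.<⇒≱ m<q (ℕD.∣⇒≤ q∣m))

congruent-≤⇒≡ : ∀ {q g g₀} → + q ∣ + g - + g₀ → g < q → g₀ ≤ g → g ≡ g₀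
congruent-≤⇒≡ {q} {g} {g₀} q∣g-g₀ g<q g₀≤g =
  ℕP.≤-antisym (ℕP.m∸n≡0⇒m≤n (∣∧<⇒≡0 q∣g∸g₀ (ℕP.≤-<-trans (ℕP.m∸n≤m g g₀) g<q))) g₀≤g
  where
  q∣g∸g₀ : q ℕD.∣ g ∸ g₀
  q∣g∸g₀ = ℤD.∣⇒∣ᵤ (subst (+ q ∣_) (trans (ℤP.[+m]-[+n]≡m⊖n g g₀) (ℤP.⊖-≥ g₀≤g)) q∣g-g₀)

congruent-<⇒≡ : ∀ {q g g₀} → + q ∣ + g - + g₀ → g < q → g₀ < q → g ≡ g₀
congruent-<⇒≡ {q} {g} {g₀} q∣g-g₀ g<q g₀<q with ℕP.≤-total g₀ g
... | inj₁ g₀≤g = congruent-≤⇒≡ q∣g-g₀ g<q g₀≤g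
... | inj₂ g≤g₀ = sym (congruent-≤⇒≡ (subst (+ q ∣_) (negate (+ g) (+ g₀)) (ℤD.∣m⇒∣-m q∣g-g₀)) g₀<q g≤g₀)
  where
  negate : ∀ a b → - (a - b) ≡ b - a
  negate = solve-∀

inverse-%ℕ : ∀ q .{{_ : NonZero q}} h G t → + h * G ≡ + 1 + + q * t → + q ∣ + h * + (G %ℕ q) - + 1
inverse-%ℕ q h G t hG≡1+qt = subst (+ q ∣_) (sym (shift (+ h) (+ (G %ℕ q)) (G /ℕ q) (+ q) G (a≡a%ℕn+[a/ℕn]*n G q)))
                                   (ℤD.∣m∣n⇒∣m-n q∣hG-1 (ℤD.∣n⇒∣m*n (+ h * (G /ℕ q)) ℤD.∣-refl))
  where
  q∣hG-1 : + q ∣ + h * G - + 1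
  q∣hG-1 = divides t (trans (cong (_- + 1) hG≡1+qt) (cancel t (+ q)))
    where
    cancel : ∀ t q → + 1 + q * t - + 1 ≡ t * q
    cancel = solve-∀
  shift : ∀ h g₀ Q q G → G ≡ g₀ + Q * q → h * g₀ - + 1 ≡ (h * G - + 1) - h * Q * q
  shift h g₀ Q q G refl = expand h g₀ Q q
    where
    expand : ∀ h g₀ Q q → h * g₀ - + 1 ≡ (h * (g₀ + Q * q) - + 1) - h * Q * q
    expand = solve-∀

inverse-unique : ∀ α {h g g₀} → OddZ (+ h) → + (2 ^ α) ∣ + h * + g - + 1 → + (2 ^ α) ∣ + h * + g₀ - + 1 →
                 g < 2 ^ α → g₀ < 2 ^ α → g ≡ g₀
inverse-unique α {h} {g} {g₀} odd-h q∣hg-1 q∣hg₀-1 = congruent-<⇒≡ q∣g-g₀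
  where
  difference : ∀ h g g₀ → (h * g - + 1) - (h * g₀ - + 1) ≡ h * (g - g₀)
  difference = solve-∀
  q∣g-g₀ : + (2 ^ α) ∣ + g - + g₀
  q∣g-g₀ = 2^∣odd*⇒2^∣ α odd-h (subst (+ (2 ^ α) ∣_) (difference (+ h) (+ g) (+ g₀)) (ℤD.∣m∣n⇒∣m-n q∣hg-1 q∣hg₀-1))

innerSum-odd : ∀ {n} α (χ : ℤ → Vec ℤ n) u h G t → 2 ^ α ≡ n ℕ.+ n → OddZ (+ h) →
               + h * G ≡ + 1 + + (2 ^ α) * t → innerSum (2 ^ α) χ u h ≡ χ (+ h) ⊛ ζ^ (u * + h + u * G)
innerSum-odd {n} α χ u h G t q≡2n odd-h hG≡1+qt = begin
  innerSum q χ u h                   ≡⟨ sumTo-single q term g₀ g₀<q others ⟩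
  term g₀                            ≡⟨ if-true (isInvPair-true q h g₀ (gcd-odd-2^ α odd-h) (ℤD.∣⇒∣ᵤ q∣hg₀-1)) ⟩
  χ (+ h) ⊛ ζ^ (u * + h + u * + g₀)  ≡⟨ cong (χ (+ h) ⊛_) (trans (cong ζ^ exponent) (ζ^-periodic (u * + h + u * G) (- (u * Q)))) ⟩
  χ (+ h) ⊛ ζ^ (u * + h + u * G)     ∎
  where
  open ≡-Reasoning
  q = 2 ^ α
  instance
    q≢0 : NonZero q
    q≢0 = ℕP.m^n≢0 2 α
  term : ℕ → Vec ℤ n
  term g = if isInvPair q h g then χ (+ h) ⊛ ζ^ (u * + h + u * + g) else 0c
  g₀ = G %ℕ q
  Q = G /ℕ q
  g₀<q : g₀ < q
  g₀<q = n%ℕd<d G q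
  q∣hg₀-1 : + q ∣ + h * + g₀ - + 1
  q∣hg₀-1 = inverse-%ℕ q h G t hG≡1+qt
  others : ∀ g → g < q → g ≢ g₀ → term g ≡ 0c
  others g g<q g≢g₀ = if-false (isInvPair-not-inverse q h g (λ q∣hg-1 → g≢g₀ (inverse-unique α odd-h (ℤD.∣ᵤ⇒∣ q∣hg-1) q∣hg₀-1 g<q g₀<q)))
  exponent : u * + h + u * + g₀ ≡ (u * + h + u * G) + + (n ℕ.+ n) * (- (u * Q))
  exponent = trans (reduce u (+ h) (+ g₀) Q (+ q) G (a≡a%ℕn+[a/ℕn]*n G q)) (cong (λ N → (u * + h + u * G) + + N * (- (u * Q))) q≡2n)
    where
    reduce : ∀ u h g₀ Q q G → G ≡ g₀ + Q * q → u * h + u * g₀ ≡ (u * h + u * G) + q * (- (u * Q))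
    reduce u h g₀ Q q G refl = expand u h g₀ Q q
      where
      expand : ∀ u h g₀ Q q → u * h + u * g₀ ≡ (u * h + u * (g₀ + Q * q)) + q * (- (u * Q))
      expand = solve-∀

-- Blocks h₀ + 2^(α-β) y of the sum

induced-periodic : ∀ {n q M} {χ : ℤ → Vec ℤ n} → InducedFrom q M χ → ∀ a k →
                   gcd ℤ.∣ a ∣ q ≡ 1 → gcd ℤ.∣ a + + M * + k ∣ q ≡ 1 → χ (a + + M * + k) ≡ χ a
induced-periodic {M = M} {χ} (χ′ , χ′-char , χ≡χ′) a k coprime-a coprime-a+Mk =
  trans (χ≡χ′ _ coprime-a+Mk) (trans (χ′-periodic k) (sym (χ≡χ′ a coprime-a)))
  where
  χ′-periodic : ∀ k → χ′ (a + + M * + k) ≡ χ′ a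
  χ′-periodic zero    = cong χ′ (trans (cong (λ z → a + z) (ℤP.*-zeroʳ (+ M))) (ℤP.+-identityʳ a))
  χ′-periodic (suc k) = begin
    χ′ (a + + M * (+ 1 + + k))   ≡⟨ cong χ′ (shift a (+ M) (+ k)) ⟩
    χ′ ((a + + M * + k) + + M)   ≡⟨ IsDirichletChar.periodic χ′-char _ ⟩
    χ′ (a + + M * + k)           ≡⟨ χ′-periodic k ⟩
    χ′ a                         ∎
    where
    open ≡-Reasoning
    shift : ∀ a M k → a + M * (+ 1 + k) ≡ (a + M * k) + M
    shift = solve-∀

-- As D² ≡ 0 modulo q, an inverse h' of h₀ lifts to the inverse h'(1 - Dyh') of h₀ + Dy.
inverse-lift : ∀ h₀ h′ D y q t E → h₀ * h′ ≡ + 1 + q * t → D * D ≡ q * E →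
               (h₀ + D * y) * (h′ * (+ 1 - D * y * h′)) ≡ + 1 + q * (t - t * D * y * h′ - E * y * y * h′ * h′)
inverse-lift h₀ h′ D y q t E h₀h′≡1+qt D²≡qE = begin
  (h₀ + D * y) * (h′ * (+ 1 - D * y * h′))
    ≡⟨ expand₁ h₀ h′ D y ⟩
  (h₀ * h′) * (+ 1 - D * y * h′) + D * y * h′ - (D * D) * y * y * h′ * h′
    ≡⟨ cong₂ (λ a b → a * (+ 1 - D * y * h′) + D * y * h′ - b * y * y * h′ * h′) h₀h′≡1+qt D²≡qE ⟩
  (+ 1 + q * t) * (+ 1 - D * y * h′) + D * y * h′ - (q * E) * y * y * h′ * h′
    ≡⟨ expand₂ h′ D y q t E ⟩
  + 1 + q * (t - t * D * y * h′ - E * y * y * h′ * h′) ∎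
  where
  open ≡-Reasoning
  expand₁ : ∀ h₀ h′ D y → (h₀ + D * y) * (h′ * (+ 1 - D * y * h′)) ≡
            (h₀ * h′) * (+ 1 - D * y * h′) + D * y * h′ - (D * D) * y * y * h′ * h′
  expand₁ = solve-∀
  expand₂ : ∀ h′ D y q t E → (+ 1 + q * t) * (+ 1 - D * y * h′) + D * y * h′ - (q * E) * y * y * h′ * h′ ≡
            + 1 + q * (t - t * D * y * h′ - E * y * y * h′ * h′)
  expand₂ = solve-∀

module Blocks (k e : ℕ) (χ : ℤ → Cyc ((suc k ℕ.+ e) ℕ.+ suc k)) (u : ℤ) where

  β = suc k
  d = β ℕ.+ e
  α = d ℕ.+ β
  n = half α
  q = 2 ^ α
  D = 2 ^ d
  M = 2 ^ β

  q≡2n : q ≡ n ℕ.+ n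
  q≡2n = cong (n ℕ.+_) (ℕP.+-identityʳ n)

  block : ℕ → Vec ℤ n
  block h₀ = sumTo M (λ y → innerSum q χ u (h₀ ℕ.+ D ℕ.* y))

  S≡sumTo-block : S α χ u u ≡ sumTo D block
  S≡sumTo-block = trans (cong (λ m → sumTo m (innerSum q χ u)) (ℕP.^-distribˡ-+-* 2 d β)) (sumTo-* D M (innerSum q χ u))

  2∣D : 2 ℕD.∣ D
  2∣D = ℕD.divides (2 ^ (k ℕ.+ e)) (ℕP.*-comm 2 (2 ^ (k ℕ.+ e)))

  block-even : ∀ h₀ → 2 ℕD.∣ h₀ → block h₀ ≡ 0c
  block-even h₀ 2∣h₀ = sumTo-zero M _ (λ y _ →
    subst (λ a → innerSum (2 ^ a) χ u (h₀ ℕ.+ D ℕ.* y) ≡ 0c) (sym (ℕP.+-suc d k))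
          (innerSum-even (d ℕ.+ k) χ u _ (ℕD.∣m∣n⇒∣m+n 2∣h₀ (ℕD.∣-trans 2∣D (ℕD.∣m⇒∣m*n y ℕD.∣-refl)))))

  D²≡q2^e : + D * + D ≡ + q * + (2 ^ e)
  D²≡q2^e = begin
    + D * + D               ≡⟨ sym (ℤP.pos-* D D) ⟩
    + (2 ^ d ℕ.* 2 ^ d)     ≡⟨ cong +_ (sym (ℕP.^-distribˡ-+-* 2 d d)) ⟩
    + (2 ^ (d ℕ.+ d))       ≡⟨ cong (λ m → + (2 ^ m)) (regroup β e) ⟩
    + (2 ^ (α ℕ.+ e))       ≡⟨ cong +_ (ℕP.^-distribˡ-+-* 2 α e) ⟩
    + (q ℕ.* 2 ^ e)         ≡⟨ ℤP.pos-* q (2 ^ e) ⟩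
    + q * + (2 ^ e)         ∎
    where
    open ≡-Reasoning
    regroup : ∀ β e → (β ℕ.+ e) ℕ.+ (β ℕ.+ e) ≡ ((β ℕ.+ e) ℕ.+ β) ℕ.+ e
    regroup = ℕ-Solver.solve-∀

  odd-+D* : ∀ {h₀} y → OddZ (+ h₀) → OddZ (+ (h₀ ℕ.+ D ℕ.* y))
  odd-+D* {h₀} y odd-h₀ = subst OddZ (sym h₀+Dy≡h₀+2[2^[k+e]y]) (odd-+-even (+ (2 ^ (k ℕ.+ e)) * + y) odd-h₀)
    where
    h₀+Dy≡h₀+2[2^[k+e]y] : + (h₀ ℕ.+ D ℕ.* y) ≡ + h₀ + + 2 * (+ (2 ^ (k ℕ.+ e)) * + y)
    h₀+Dy≡h₀+2[2^[k+e]y] = trans (pos-+-* h₀ D y) (cong (λ z → + h₀ + z)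
      (trans (cong (_* + y) (ℤP.pos-* 2 (2 ^ (k ℕ.+ e)))) (ℤP.*-assoc (+ 2) (+ (2 ^ (k ℕ.+ e))) (+ y))))

  χ-+D* : InducedFrom q M χ → ∀ {h₀} y → OddZ (+ h₀) → χ (+ (h₀ ℕ.+ D ℕ.* y)) ≡ χ (+ h₀)
  χ-+D* induced {h₀} y odd-h₀ = trans (cong χ h₀+Dy≡h₀+M2^ey)
    (induced-periodic induced (+ h₀) (2 ^ e ℕ.* y) (gcd-odd-2^ α odd-h₀) (gcd-odd-2^ α (subst OddZ h₀+Dy≡h₀+M2^ey (odd-+D* y odd-h₀))))
    where
    h₀+Dy≡h₀+M2^ey : + (h₀ ℕ.+ D ℕ.* y) ≡ + h₀ + + M * + (2 ^ e ℕ.* y)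
    h₀+Dy≡h₀+M2^ey = trans (cong (λ m → + (h₀ ℕ.+ m ℕ.* y)) (ℕP.^-distribˡ-+-* 2 β e))
                           (trans (cong (λ m → + (h₀ ℕ.+ m)) (ℕP.*-assoc M (2 ^ e) y)) (pos-+-* h₀ M (2 ^ e ℕ.* y)))

  innerSum-+D* : InducedFrom q M χ → ∀ h₀ h′ t y → OddZ (+ h₀) → + h₀ * h′ ≡ + 1 + + q * t →
                 innerSum q χ u (h₀ ℕ.+ D ℕ.* y) ≡ χ (+ h₀) ⊛ (ζ^ (u * (+ h₀ + h′)) ⊛ ζ^ (+ D * (u * (+ 1 - h′ * h′)) * + y))
  innerSum-+D* induced h₀ h′ t y odd-h₀ h₀h′≡1+qt = begin
    innerSum q χ u h                      ≡⟨ innerSum-odd α χ u h G t′ q≡2n (odd-+D* y odd-h₀) hG≡1+qt′ ⟩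
    χ (+ h) ⊛ ζ^ (u * + h + u * G)        ≡⟨ cong₂ _⊛_ (χ-+D* induced y odd-h₀) (cong ζ^ exponent) ⟩
    χ (+ h₀) ⊛ ζ^ (u * (+ h₀ + h′) + c)   ≡⟨ cong (χ (+ h₀) ⊛_) (ζ^-+ (u * (+ h₀ + h′)) c) ⟩
    χ (+ h₀) ⊛ (ζ^ (u * (+ h₀ + h′)) ⊛ ζ^ c) ∎
    where
    open ≡-Reasoning
    h = h₀ ℕ.+ D ℕ.* y
    G = h′ * (+ 1 - + D * + y * h′)
    t′ = t - t * + D * + y * h′ - + (2 ^ e) * + y * + y * h′ * h′
    c = + D * (u * (+ 1 - h′ * h′)) * + y
    hG≡1+qt′ : + h * G ≡ + 1 + + q * t′
    hG≡1+qt′ = trans (cong (_* G) (pos-+-* h₀ D y)) (inverse-lift (+ h₀) h′ (+ D) (+ y) (+ q) t (+ (2 ^ e)) h₀h′≡1+qt D²≡q2^e)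
    exponent : u * + h + u * G ≡ u * (+ h₀ + h′) + c
    exponent = trans (cong (λ z → u * z + u * G) (pos-+-* h₀ D y)) (regroup u (+ h₀) (+ D) (+ y) h′)
      where
      regroup : ∀ u h₀ D y h′ → u * (h₀ + D * y) + u * (h′ * (+ 1 - D * y * h′)) ≡ u * (h₀ + h′) + D * (u * (+ 1 - h′ * h′)) * y
      regroup = solve-∀

  block-odd : InducedFrom q M χ → ∀ h₀ h′ t → OddZ (+ h₀) → + h₀ * h′ ≡ + 1 + + q * t →
              block h₀ ≡ χ (+ h₀) ⊛ (ζ^ (u * (+ h₀ + h′)) ⊛ sumTo M (λ y → ζ^ (+ D * (u * (+ 1 - h′ * h′)) * + y)))
  block-odd induced h₀ h′ t odd-h₀ h₀h′≡1+qt = begin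
    block h₀                                   ≡⟨ sumTo-cong M (λ y _ → innerSum-+D* induced h₀ h′ t y odd-h₀ h₀h′≡1+qt) ⟩
    sumTo M (λ y → χ (+ h₀) ⊛ (ω₀ ⊛ ω y))      ≡⟨ sumTo-⊛ M (χ (+ h₀)) _ ⟩
    χ (+ h₀) ⊛ sumTo M (λ y → ω₀ ⊛ ω y)        ≡⟨ cong (χ (+ h₀) ⊛_) (sumTo-⊛ M ω₀ ω) ⟩
    χ (+ h₀) ⊛ (ω₀ ⊛ sumTo M ω)                ∎
    where
    open ≡-Reasoning
    ω₀ = ζ^ (u * (+ h₀ + h′))
    ω : ℕ → Cyc α
    ω y = ζ^ (+ D * (u * (+ 1 - h′ * h′)) * + y)

-- Square roots of 1 modulo powers of 2

modular-inverse : ∀ h q → gcd h q ≡ 1 → Σ ℤ λ h′ → Σ ℤ λ t → + h * h′ ≡ + 1 + + q * t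
modular-inverse h q gcd≡1 with coprime-Bézout (gcd≡1⇒coprime {h} {q} gcd≡1)
... | Bézout.+- x y 1+yq≡xh = + x , + y , hx≡1+qy
  where
  open ≡-Reasoning
  hx≡1+qy : + h * + x ≡ + 1 + + q * + y
  hx≡1+qy = begin
    + h * + x         ≡⟨ sym (ℤP.pos-* h x) ⟩
    + (h ℕ.* x)       ≡⟨ cong +_ (trans (ℕP.*-comm h x) (trans (sym 1+yq≡xh) (cong (1 ℕ.+_) (ℕP.*-comm y q)))) ⟩
    + (1 ℕ.+ q ℕ.* y) ≡⟨ pos-+-* 1 q y ⟩
    + 1 + + q * + y   ∎
... | Bézout.-+ x y 1+xh≡yq = - + x , - + y , h[-x]≡1+q[-y]
  where
  open ≡-Reasoning
  regroup₁ : ∀ h x → h * - x ≡ + 1 - (+ 1 + x * h)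
  regroup₁ = solve-∀
  regroup₂ : ∀ y q → + 1 - y * q ≡ + 1 + q * - y
  regroup₂ = solve-∀
  h[-x]≡1+q[-y] : + h * - + x ≡ + 1 + + q * - + y
  h[-x]≡1+q[-y] = begin
    + h * - + x              ≡⟨ regroup₁ (+ h) (+ x) ⟩
    + 1 - (+ 1 + + x * + h)  ≡⟨ cong (λ z → + 1 - z) (trans (sym (pos-+-* 1 x h)) (trans (cong +_ 1+xh≡yq) (ℤP.pos-* y q))) ⟩
    + 1 - + y * + q          ≡⟨ regroup₂ (+ y) (+ q) ⟩
    + 1 + + q * - + y        ∎

parityℕ : ∀ r → Σ ℕ (λ a → r ≡ 2 ℕ.* a) ⊎ Σ ℕ (λ a → r ≡ suc (2 ℕ.* a))
parityℕ zero    = inj₁ (0 , refl)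
parityℕ (suc r) with parityℕ r
... | inj₁ (a , r≡2a)   = inj₂ (a , cong suc r≡2a)
... | inj₂ (a , r≡2a+1) = inj₁ (suc a , trans (cong suc r≡2a+1) (cong suc (sym (ℕP.+-suc a (a ℕ.+ 0)))))

2^∣A[A+1] : ∀ k {A} → + (2 ^ k) ∣ A * (A + + 1) → + (2 ^ k) ∣ A ⊎ + (2 ^ k) ∣ A + + 1
2^∣A[A+1] k {A} 2^k∣A[A+1] with parity A
... | inj₂ odd-A = inj₂ (2^∣odd*⇒2^∣ k odd-A 2^k∣A[A+1])
... | inj₁ (divides A′ A≡A′*2) = inj₁ (2^∣odd*⇒2^∣ k odd-A+1 (subst (+ (2 ^ k) ∣_) (ℤP.*-comm A (A + + 1)) 2^k∣A[A+1]))
  where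
  swap : ∀ A′ → A′ * + 2 + + 1 ≡ + 1 + + 2 * A′
  swap = solve-∀
  odd-A+1 : OddZ (A + + 1)
  odd-A+1 = A′ , trans (cong (_+ + 1) A≡A′*2) (swap A′)

-- Writing h = 1 + 2A, h² - 1 = 4A(A + 1).
square≡1⇒±1 : ∀ k r j → r < 2 ^ suc k → OddZ (+ (r ℕ.+ 2 ^ suc k ℕ.* j)) →
              + (2 ^ (2 ℕ.+ k)) ∣ + (r ℕ.+ 2 ^ suc k ℕ.* j) * + (r ℕ.+ 2 ^ suc k ℕ.* j) - + 1 →
              r ≡ 1 ⊎ suc r ≡ 2 ^ suc k
square≡1⇒±1 k r j r<2w odd-h 4w∣h²-1 with parityℕ r
... | inj₁ (a , refl) = ⊥-elim (odd⇒2∤ odd-h (divides (+ (a ℕ.+ 2 ^ k ℕ.* j)) even))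
  where
  even : + (2 ℕ.* a ℕ.+ 2 ^ suc k ℕ.* j) ≡ + (a ℕ.+ 2 ^ k ℕ.* j) * + 2
  even = trans (cong +_ (trans (cong (2 ℕ.* a ℕ.+_) (ℕP.*-assoc 2 (2 ^ k) j))
                              (trans (sym (ℕP.*-distribˡ-+ 2 a (2 ^ k ℕ.* j))) (ℕP.*-comm 2 (a ℕ.+ 2 ^ k ℕ.* j)))))
               (ℤP.pos-* (a ℕ.+ 2 ^ k ℕ.* j) 2)
... | inj₂ (a , refl) = ±1 (2^∣A[A+1] k w∣A[A+1])
  where
  w = 2 ^ k
  A = + a + + w * + j
  a<w : a < w
  a<w = ℕP.*-cancelˡ-< 2 a w (ℕP.<-trans (ℕP.n<1+n (2 ℕ.* a)) r<2w)
  h≡1+2A : + (suc (2 ℕ.* a) ℕ.+ 2 ^ suc k ℕ.* j) ≡ + 1 + + 2 * A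
  h≡1+2A = trans (pos-+-* (suc (2 ℕ.* a)) (2 ^ suc k) j)
                 (trans (cong₂ (λ s t → s + t * + j) (pos-+-* 1 2 a) (2^suc k)) (regroup (+ a) (+ w) (+ j)))
    where
    regroup : ∀ a w j → (+ 1 + + 2 * a) + (+ 2 * w) * j ≡ + 1 + + 2 * (a + w * j)
    regroup = solve-∀
  w∣A[A+1] : + w ∣ A * (A + + 1)
  w∣A[A+1] = ℤD.*-cancelˡ-∣ (+ 4) (subst₂ _∣_ 2^[2+k]≡4w (trans (cong (λ z → z * z - + 1) h≡1+2A) (factor A)) 4w∣h²-1)
    where
    2^[2+k]≡4w : + (2 ^ (2 ℕ.+ k)) ≡ + 4 * + w
    2^[2+k]≡4w = trans (cong +_ (sym (ℕP.*-assoc 2 2 w))) (ℤP.pos-* 4 w)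
    factor : ∀ A → (+ 1 + + 2 * A) * (+ 1 + + 2 * A) - + 1 ≡ + 4 * (A * (A + + 1))
    factor = solve-∀
  drop-wj : ∀ {c} → + w ∣ A + c → + w ∣ + a + c
  drop-wj {c} w∣A+c = subst (+ w ∣_) (cancel (+ a) (+ w) (+ j) c) (ℤD.∣m∣n⇒∣m-n w∣A+c (ℤD.∣m⇒∣m*n (+ j) ℤD.∣-refl))
    where
    cancel : ∀ a w j c → a + w * j + c - w * j ≡ a + c
    cancel = solve-∀
  ±1 : + w ∣ A ⊎ + w ∣ A + + 1 → suc (2 ℕ.* a) ≡ 1 ⊎ suc (suc (2 ℕ.* a)) ≡ 2 ^ suc k
  ±1 (inj₁ w∣A)   = inj₁ (cong (λ z → suc (2 ℕ.* z)) (∣∧<⇒≡0 (ℤD.∣⇒∣ᵤ w∣a) a<w))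
    where
    w∣a : + w ∣ + a
    w∣a = subst (+ w ∣_) (ℤP.+-identityʳ (+ a)) (drop-wj (subst (+ w ∣_) (sym (ℤP.+-identityʳ A)) w∣A))
  ±1 (inj₂ w∣A+1) = inj₂ (trans (sym (ℕP.*-suc 2 a)) (cong (2 ℕ.*_) (ℕP.≤-antisym a<w (ℕD.∣⇒≤ (ℤD.∣⇒∣ᵤ w∣1+a)))))
    where
    w∣1+a : + w ∣ + suc a
    w∣1+a = subst (+ w ∣_) (ℤP.+-comm (+ a) (+ 1)) (drop-wj w∣A+1)

square≡1-from-inverse : ∀ m {h h′ s u} → OddZ u → h * h′ ≡ + 1 + + (2 ^ m) * s →
                        + (2 ^ m) ∣ u * (+ 1 - h′ * h′) → + (2 ^ m) ∣ h * h - + 1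
square≡1-from-inverse m {h} {h′} {s} odd-u hh′≡1+Ms M∣u[1-h′²] =
  subst (+ (2 ^ m) ∣_) (sym (trans (split h h′) (cong (λ z → h * h * (+ 1 - h′ * h′) + (z * z - + 1)) hh′≡1+Ms)))
        (ℤD.∣m∣n⇒∣m+n (ℤD.∣n⇒∣m*n (h * h) (2^∣odd*⇒2^∣ m odd-u M∣u[1-h′²]))
                      (subst (+ (2 ^ m) ∣_) (sym (expand (+ (2 ^ m)) s)) (ℤD.∣m⇒∣m*n _ ℤD.∣-refl)))
  where
  split : ∀ h h′ → h * h - + 1 ≡ h * h * (+ 1 - h′ * h′) + ((h * h′) * (h * h′) - + 1)
  split = solve-∀
  expand : ∀ M s → (+ 1 + M * s) * (+ 1 + M * s) - + 1 ≡ M * (s * (+ 2 + M * s))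
  expand = solve-∀

-- Collapse onto h₀ ≡ ±1 modulo 2^(β-1)

sumTo-pair : ∀ {n} m (f : ℕ → Vec ℤ n) → 1 < m → (∀ r → r < m → r ≢ 1 → f r ≡ 0c) → sumTo (suc m) f ≡ f 1 ⊕ f m
sumTo-pair m f 1<m others = cong (_⊕ f m) (sumTo-single m f 1 1<m others)

±1-square : ∀ {ε} → ε ≡ + 1 ⊎ ε ≡ - + 1 → ε * ε ≡ + 1
±1-square (inj₁ refl) = refl
±1-square (inj₂ refl) = refl

±1-odd : ∀ {ε} → ε ≡ + 1 ⊎ ε ≡ - + 1 → OddZ ε
±1-odd (inj₁ refl) = + 0 , refl
±1-odd (inj₂ refl) = - + 1 , refl

-- For ε = ±1 this is the inverse of ε + Y modulo Y⁴ (a truncated geometric series).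
inverseMod⁴ : ℤ → ℤ → ℤ
inverseMod⁴ ε Y = (ε - Y) * (+ 1 + Y * Y)

inverseMod⁴-inverse : ∀ {ε} Y → ε ≡ + 1 ⊎ ε ≡ - + 1 → (ε + Y) * inverseMod⁴ ε Y ≡ + 1 - Y * Y * Y * Y
inverseMod⁴-inverse {ε} Y ε≡±1 = begin
  (ε + Y) * ((ε - Y) * (+ 1 + Y * Y))                              ≡⟨ expand ε Y ⟩
  + 1 - Y * Y * Y * Y + (ε * ε - + 1) * (+ 1 + Y * Y)              ≡⟨ cong (λ z → + 1 - Y * Y * Y * Y + (z - + 1) * (+ 1 + Y * Y)) (±1-square ε≡±1) ⟩
  + 1 - Y * Y * Y * Y + (+ 1 - + 1) * (+ 1 + Y * Y)                ≡⟨ vanish (+ 1 - Y * Y * Y * Y) (+ 1 + Y * Y) ⟩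
  + 1 - Y * Y * Y * Y                                              ∎
  where
  open ≡-Reasoning
  expand : ∀ ε Y → (ε + Y) * ((ε - Y) * (+ 1 + Y * Y)) ≡ + 1 - Y * Y * Y * Y + (ε * ε - + 1) * (+ 1 + Y * Y)
  expand = solve-∀
  vanish : ∀ a s → a + (+ 1 - + 1) * s ≡ a
  vanish = solve-∀

8V∣u[1-inverseMod⁴²] : ∀ {ε} u V J → ε ≡ + 1 ⊎ ε ≡ - + 1 →
                        + 8 * V ∣ u * (+ 1 - inverseMod⁴ ε (+ 4 * V * J) * inverseMod⁴ ε (+ 4 * V * J))
8V∣u[1-inverseMod⁴²] {ε} u V J ε≡±1 = divides (u * C) (begin
  u * (+ 1 - G * G)                                                     ≡⟨ expand u ε V J ⟩
  u * C * (+ 8 * V) + u * ((+ 1 - ε * ε) * (R * R))                     ≡⟨ cong (λ z → u * C * (+ 8 * V) + u * ((+ 1 - z) * (R * R))) (±1-square ε≡±1) ⟩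
  u * C * (+ 8 * V) + u * ((+ 1 - + 1) * (R * R))                       ≡⟨ vanish (u * C * (+ 8 * V)) u (R * R) ⟩
  u * C * (+ 8 * V)                                                     ∎)
  where
  open ≡-Reasoning
  Y = + 4 * V * J
  G = inverseMod⁴ ε Y
  R = + 1 + Y * Y
  C = J * (ε * (R * R) - + 2 * V * J * (+ 3 + + 3 * (Y * Y) + Y * Y * Y * Y))
  vanish : ∀ a u s → a + u * ((+ 1 - + 1) * s) ≡ a
  vanish = solve-∀
  expand : ∀ u ε V J →
           u * (+ 1 - ((ε - + 4 * V * J) * (+ 1 + + 4 * V * J * (+ 4 * V * J))) * ((ε - + 4 * V * J) * (+ 1 + + 4 * V * J * (+ 4 * V * J)))) ≡
           u * (J * (ε * ((+ 1 + + 4 * V * J * (+ 4 * V * J)) * (+ 1 + + 4 * V * J * (+ 4 * V * J)))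
                    - + 2 * V * J * (+ 3 + + 3 * (+ 4 * V * J * (+ 4 * V * J)) + + 4 * V * J * (+ 4 * V * J) * (+ 4 * V * J) * (+ 4 * V * J))))
             * (+ 8 * V)
           + u * ((+ 1 - ε * ε) * ((+ 1 + + 4 * V * J * (+ 4 * V * J)) * (+ 1 + + 4 * V * J * (+ 4 * V * J))))
  expand = solve-∀

-- u(h₀ + h₀⁻¹) for h₀ = ε + 4VJ, with h₀⁻¹ = inverseMod⁴ ε (4VJ) modulo q.
blockExponent : ℤ → ℤ → ℤ → ℤ → ℤ
blockExponent V u ε J = u * (+ 2 * ε + ε * (+ 4 * V * J) * (+ 4 * V * J) - + 4 * V * J * (+ 4 * V * J) * (+ 4 * V * J))

-- β = 3 + b and α = 2β + e; with V = 2^b we have x = 2^(β-1) = 4V and M = 2^β = 8V.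
module Collapse (b e : ℕ) (χ : ℤ → Cyc ((suc (suc (suc b)) ℕ.+ e) ℕ.+ suc (suc (suc b)))) (u : ℤ) where

  open Blocks (suc (suc b)) e χ u public

  V = + (2 ^ b)
  E = + (2 ^ e)
  x = 2 ^ suc (suc b)

  x≡4V : + x ≡ + 4 * V
  x≡4V = pos-2^+ 2 b

  M≡8V : + M ≡ + 8 * V
  M≡8V = pos-2^+ 3 b

  2^[α∸3]≡8V²E : + (2 ^ (α ∸ 3)) ≡ + 8 * V * V * E
  2^[α∸3]≡8V²E = begin
    + (2 ^ ((b ℕ.+ e) ℕ.+ (3 ℕ.+ b)))         ≡⟨ pos-2^+ (b ℕ.+ e) (3 ℕ.+ b) ⟩
    + (2 ^ (b ℕ.+ e)) * + (2 ^ (3 ℕ.+ b))     ≡⟨ cong₂ _*_ (pos-2^+ b e) M≡8V ⟩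
    V * E * (+ 8 * V)                         ≡⟨ regroup V E ⟩
    + 8 * V * V * E                           ∎
    where
    open ≡-Reasoning
    regroup : ∀ V E → V * E * (+ 8 * V) ≡ + 8 * V * V * E
    regroup = solve-∀

  2^[α∸2]≡16V²E : + (2 ^ (α ∸ 2)) ≡ + 16 * V * V * E
  2^[α∸2]≡16V²E = trans (ℤP.pos-* 2 (2 ^ (α ∸ 3))) (trans (cong (λ z → + 2 * z) 2^[α∸3]≡8V²E) (double V E))
    where
    double : ∀ V E → + 2 * (+ 8 * V * V * E) ≡ + 16 * V * V * E
    double = solve-∀

  n≡32V²E : + n ≡ + 32 * V * V * E
  n≡32V²E = trans (ℤP.pos-* 2 (2 ^ (α ∸ 2))) (trans (cong (λ z → + 2 * z) 2^[α∸2]≡16V²E) (double V E))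
    where
    double : ∀ V E → + 2 * (+ 16 * V * V * E) ≡ + 32 * V * V * E
    double = solve-∀

  2n≡64V²E : + (n ℕ.+ n) ≡ + 64 * V * V * E
  2n≡64V²E = trans (ℤP.pos-+ n n) (trans (cong₂ _+_ n≡32V²E n≡32V²E) (double V E))
    where
    double : ∀ V E → + 32 * V * V * E + + 32 * V * V * E ≡ + 64 * V * V * E
    double = solve-∀

  ζ^-mod : ∀ {a} c t → a ≡ c + + 64 * V * V * E * t → ζ^ {n} a ≡ ζ^ c
  ζ^-mod c t a≡c+qt = trans (cong ζ^ (trans a≡c+qt (cong (λ N → c + N * t) (sym 2n≡64V²E)))) (ζ^-periodic c t)

  ζ^-+n : ∀ a → ζ^ {n} (a + + n) ≡ ⊖ ζ^ a
  ζ^-+n a = begin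
    ζ^ (a + + n)       ≡⟨ ζ^-+ a (+ n) ⟩
    ζ^ a ⊛ ζ^ (+ n)    ≡⟨ cong (ζ^ a ⊛_) ζ^-half ⟩
    ζ^ a ⊛ ⊖ 1c        ≡⟨ ⊛-⊖ (ζ^ a) 1c ⟩
    ⊖ (ζ^ a ⊛ 1c)      ≡⟨ cong ⊖_ (⊛-identityʳ (ζ^ a)) ⟩
    ⊖ ζ^ a             ∎
    where open ≡-Reasoning

  Y : ℤ → ℤ
  Y J = + 4 * V * J

  q≡64V²E : + q ≡ + 64 * V * V * E
  q≡64V²E = trans (cong +_ q≡2n) 2n≡64V²E

  4≤x : 4 ≤ x
  4≤x = ℕP.≤-trans (ℕP.*-monoʳ-≤ 4 (ℕP.m^n>0 2 b)) (ℕP.≤-reflexive (ℕP.*-assoc 2 2 (2 ^ b)))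

  1+[x-1]≡x : suc (x ∸ 1) ≡ x
  1+[x-1]≡x = ℕP.m+[n∸m]≡n {1} {x} (ℕP.≤-trans (s≤s z≤n) 4≤x)

  1+xj≡1+Y : ∀ j → + (1 ℕ.+ x ℕ.* j) ≡ + 1 + Y (+ j)
  1+xj≡1+Y j = trans (pos-+-* 1 x j) (cong (λ z → + 1 + z * + j) x≡4V)

  x-1+xj≡-1+Y : ∀ j → + (x ∸ 1 ℕ.+ x ℕ.* j) ≡ - + 1 + Y (+ 1 + + j)
  x-1+xj≡-1+Y j = begin
    + (x ∸ 1 ℕ.+ x ℕ.* j)                  ≡⟨ pos-+-* (x ∸ 1) x j ⟩
    + (x ∸ 1) + + x * + j                  ≡⟨ cong (λ z → z + + x * + j) (shift (+ (x ∸ 1))) ⟩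
    - + 1 + (+ 1 + + (x ∸ 1)) + + x * + j  ≡⟨ cong (λ m → - + 1 + + m + + x * + j) 1+[x-1]≡x ⟩
    - + 1 + + x + + x * + j                ≡⟨ cong (λ z → - + 1 + z + z * + j) x≡4V ⟩
    - + 1 + + 4 * V + + 4 * V * + j        ≡⟨ regroup V (+ j) ⟩
    - + 1 + Y (+ 1 + + j)                  ∎
    where
    open ≡-Reasoning
    shift : ∀ z → z ≡ - + 1 + (+ 1 + z)
    shift = solve-∀
    regroup : ∀ V j → - + 1 + + 4 * V + + 4 * V * j ≡ - + 1 + + 4 * V * (+ 1 + j)
    regroup = solve-∀

  classSum : ℕ → Cyc α
  classSum r = sumTo (2 ^ suc e) (λ j → block (r ℕ.+ x ℕ.* j))

  module _ (induced : InducedFrom q M χ) (odd-u : OddZ u) where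

    block-vanishes-odd : ∀ r j → r < x → r ≢ 1 → suc r ≢ x → OddZ (+ (r ℕ.+ x ℕ.* j)) →
                         ∀ h′ t → + (r ℕ.+ x ℕ.* j) * h′ ≡ + 1 + + q * t → block (r ℕ.+ x ℕ.* j) ≡ 0c
    block-vanishes-odd r j r<x r≢1 r+1≢x odd-h h′ t hh′≡1+qt = begin
      block h                                   ≡⟨ block-odd induced h h′ t odd-h hh′≡1+qt ⟩
      χ (+ h) ⊛ (ζ^ (u * (+ h + h′)) ⊛ sumTo M ω) ≡⟨ cong (λ z → χ (+ h) ⊛ (ζ^ (u * (+ h + h′)) ⊛ z)) (geometricSum-∤ β d c q≡2n M∤c) ⟩
      χ (+ h) ⊛ (ζ^ (u * (+ h + h′)) ⊛ 0c)       ≡⟨ cong (χ (+ h) ⊛_) (⊛-zeroʳ (ζ^ (u * (+ h + h′)))) ⟩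
      χ (+ h) ⊛ 0c                              ≡⟨ ⊛-zeroʳ (χ (+ h)) ⟩
      0c                                        ∎
      where
      open ≡-Reasoning
      h = r ℕ.+ x ℕ.* j
      c = u * (+ 1 - h′ * h′)
      ω : ℕ → Cyc α
      ω y = ζ^ (+ D * c * + y)
      hh′≡1+M[Dt] : + h * h′ ≡ + 1 + + M * (+ D * t)
      hh′≡1+M[Dt] = trans hh′≡1+qt (cong (λ z → + 1 + z) (trans (cong (_* t) (pos-2^+ d β)) (regroup (+ D) (+ M) t)))
        where
        regroup : ∀ D M t → D * M * t ≡ M * (D * t)
        regroup = solve-∀
      M∤c : ¬ (+ M ∣ c)
      M∤c M∣c with square≡1⇒±1 (suc b) r j r<x odd-h (square≡1-from-inverse β {+ h} {h′} odd-u hh′≡1+M[Dt] M∣c)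
      ... | inj₁ r≡1   = r≢1 r≡1
      ... | inj₂ r+1≡x = r+1≢x r+1≡x

    block-vanishes : ∀ r j → r < x → r ≢ 1 → suc r ≢ x → block (r ℕ.+ x ℕ.* j) ≡ 0c
    block-vanishes r j r<x r≢1 r+1≢x with parity (+ (r ℕ.+ x ℕ.* j))
    ... | inj₁ 2∣h  = block-even _ (ℤD.∣⇒∣ᵤ 2∣h)
    ... | inj₂ odd-h with modular-inverse (r ℕ.+ x ℕ.* j) q (gcd-odd-2^ α odd-h)
    ...   | h′ , t , hh′≡1+qt = block-vanishes-odd r j r<x r≢1 r+1≢x odd-h h′ t hh′≡1+qt

    S-collapse : S α χ u u ≡ classSum 1 ⊕ classSum (x ∸ 1)
    S-collapse = begin
      S α χ u u                      ≡⟨ S≡sumTo-block ⟩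
      sumTo D block                  ≡⟨ cong (λ m → sumTo m block) D≡x*2^[1+e] ⟩
      sumTo (x ℕ.* 2 ^ suc e) block  ≡⟨ sumTo-* x (2 ^ suc e) block ⟩
      sumTo x classSum               ≡⟨ cong (λ m → sumTo m classSum) (sym 1+[x-1]≡x) ⟩
      sumTo (suc (x ∸ 1)) classSum   ≡⟨ sumTo-pair (x ∸ 1) classSum 1<x-1 classSum-vanishes ⟩
      classSum 1 ⊕ classSum (x ∸ 1)  ∎
      where
      open ≡-Reasoning
      D≡x*2^[1+e] : D ≡ x ℕ.* 2 ^ suc e
      D≡x*2^[1+e] = trans (cong (λ m → 2 ^ suc (suc m)) (sym (ℕP.+-suc b e))) (ℕP.^-distribˡ-+-* 2 (suc (suc b)) (suc e))
      1<x-1 : 1 < x ∸ 1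
      1<x-1 = ℕP.≤-trans (ℕP.n≤1+n 2) (ℕP.∸-monoˡ-≤ 1 4≤x)
      classSum-vanishes : ∀ r → r < x ∸ 1 → r ≢ 1 → classSum r ≡ 0c
      classSum-vanishes r r<x-1 r≢1 = sumTo-zero (2 ^ suc e) _ (λ j _ → block-vanishes r j r<x r≢1 r+1≢x)
        where
        r<x : r < x
        r<x = ℕP.<-trans r<x-1 (subst (x ∸ 1 <_) 1+[x-1]≡x ℕP.≤-refl)
        r+1≢x : suc r ≢ x
        r+1≢x r+1≡x = ℕP.<-irrefl (ℕP.suc-injective (trans r+1≡x (sym 1+[x-1]≡x))) r<x-1

    -- w = 4V²/E, so that q = 64V²E divides Y⁴ = 256V⁴J⁴.
    module _ (w : ℤ) (Ew≡4V² : E * w ≡ + 4 * V * V) where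

      q*t≡-Y⁴ : ∀ J → + q * - (w * J * J * J * J) ≡ - (Y J * Y J * Y J * Y J)
      q*t≡-Y⁴ J = begin
        + q * - (w * J * J * J * J)                      ≡⟨ cong (_* - (w * J * J * J * J)) q≡64V²E ⟩
        + 64 * V * V * E * - (w * J * J * J * J)         ≡⟨ regroup V E w J ⟩
        - (+ 64 * V * V * (E * w) * J * J * J * J)       ≡⟨ cong (λ z → - (+ 64 * V * V * z * J * J * J * J)) Ew≡4V² ⟩
        - (+ 64 * V * V * (+ 4 * V * V) * J * J * J * J) ≡⟨ expand V J ⟩
        - (Y J * Y J * Y J * Y J)                        ∎
        where
        open ≡-Reasoning
        regroup : ∀ V E w J → + 64 * V * V * E * - (w * J * J * J * J) ≡ - (+ 64 * V * V * (E * w) * J * J * J * J)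
        regroup = solve-∀
        expand : ∀ V J → - (+ 64 * V * V * (+ 4 * V * V) * J * J * J * J) ≡ - (+ 4 * V * J * (+ 4 * V * J) * (+ 4 * V * J) * (+ 4 * V * J))
        expand = solve-∀

      block-special : ∀ h₀ ε J → ε ≡ + 1 ⊎ ε ≡ - + 1 → + h₀ ≡ ε + Y J →
                      block h₀ ≡ (+ M) · (χ (+ h₀) ⊛ ζ^ (blockExponent V u ε J))
      block-special h₀ ε J ε≡±1 h₀≡ε+YJ = begin
        block h₀                                          ≡⟨ block-odd induced h₀ G _ odd-h₀ h₀G≡1+qt ⟩
        χ (+ h₀) ⊛ (ω₀ ⊛ sumTo M ω)                       ≡⟨ cong (λ z → χ (+ h₀) ⊛ (ω₀ ⊛ z)) (geometricSum-∣ β d c q≡2n M∣c) ⟩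
        χ (+ h₀) ⊛ (ω₀ ⊛ (+ M) · 1c)                      ≡⟨ cong (χ (+ h₀) ⊛_) (trans (⊛-· (+ M) ω₀ 1c) (cong ((+ M) ·_) (⊛-identityʳ ω₀))) ⟩
        χ (+ h₀) ⊛ (+ M) · ω₀                             ≡⟨ ⊛-· (+ M) (χ (+ h₀)) ω₀ ⟩
        (+ M) · (χ (+ h₀) ⊛ ω₀)                           ≡⟨ cong (λ z → (+ M) · (χ (+ h₀) ⊛ ζ^ z)) exponent ⟩
        (+ M) · (χ (+ h₀) ⊛ ζ^ (blockExponent V u ε J))   ∎
        where
        open ≡-Reasoning
        G = inverseMod⁴ ε (Y J)
        c = u * (+ 1 - G * G)
        ω₀ = ζ^ (u * (+ h₀ + G))
        ω : ℕ → Cyc α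
        ω y = ζ^ (+ D * c * + y)
        odd-h₀ : OddZ (+ h₀)
        odd-h₀ = subst OddZ (sym (trans h₀≡ε+YJ (regroup ε V J))) (odd-+-even (+ 2 * V * J) (±1-odd ε≡±1))
          where
          regroup : ∀ ε V J → ε + + 4 * V * J ≡ ε + + 2 * (+ 2 * V * J)
          regroup = solve-∀
        h₀G≡1+qt : + h₀ * G ≡ + 1 + + q * - (w * J * J * J * J)
        h₀G≡1+qt = trans (cong (_* G) h₀≡ε+YJ) (trans (inverseMod⁴-inverse (Y J) ε≡±1) (cong (λ z → + 1 + z) (sym (q*t≡-Y⁴ J))))
        M∣c : + M ∣ c
        M∣c = subst (_∣ c) (sym M≡8V) (8V∣u[1-inverseMod⁴²] u V J ε≡±1)
        exponent : u * (+ h₀ + G) ≡ blockExponent V u ε J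
        exponent = trans (cong (λ z → u * (z + G)) h₀≡ε+YJ) (regroup u ε (Y J))
          where
          regroup : ∀ u ε Y → u * ((ε + Y) + (ε - Y) * (+ 1 + Y * Y)) ≡ u * (+ 2 * ε + ε * Y * Y - Y * Y * Y)
          regroup = solve-∀

      block⁺ : ∀ j → block (1 ℕ.+ x ℕ.* j) ≡ (+ M) · (χ (+ (1 ℕ.+ x ℕ.* j)) ⊛ ζ^ (blockExponent V u (+ 1) (+ j)))
      block⁺ j = block-special (1 ℕ.+ x ℕ.* j) (+ 1) (+ j) (inj₁ refl) (1+xj≡1+Y j)

      block⁻ : ∀ j → block (x ∸ 1 ℕ.+ x ℕ.* j) ≡ (+ M) · (χ (+ (x ∸ 1 ℕ.+ x ℕ.* j)) ⊛ ζ^ (blockExponent V u (- + 1) (+ 1 + + j)))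
      block⁻ j = block-special (x ∸ 1 ℕ.+ x ℕ.* j) (- + 1) (+ 1 + + j) (inj₂ refl) (x-1+xj≡-1+Y j)

-- The case α = 2β

induced-periodic-odd : ∀ {n α m} {χ : ℤ → Vec ℤ n} → InducedFrom (2 ^ α) (2 ^ suc m) χ →
                       ∀ a j → OddZ a → χ (a + + (2 ^ suc m) * + j) ≡ χ a
induced-periodic-odd {α = α} {m} induced a j odd-a =
  induced-periodic induced a j (gcd-odd-2^ α odd-a) (gcd-odd-2^ α (subst OddZ (sym a+Mj≡a+2[2^m*j]) (odd-+-even _ odd-a)))
  where
  a+Mj≡a+2[2^m*j] : a + + (2 ^ suc m) * + j ≡ a + + 2 * (+ (2 ^ m) * + j)
  a+Mj≡a+2[2^m*j] = cong (λ z → a + z) (trans (cong (_* + j) (ℤP.pos-* 2 (2 ^ m))) (ℤP.*-assoc (+ 2) (+ (2 ^ m)) (+ j)))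

ζ^-⊛-ζ^ : ∀ {n} a c (z : Vec ℤ n) → ζ^ a ⊛ (ζ^ c ⊛ z) ≡ z ⊛ ζ^ (a + c)
ζ^-⊛-ζ^ a c z = trans (sym (⊛-assoc (ζ^ a) (ζ^ c) z)) (trans (cong (_⊛ z) (sym (ζ^-+ a c))) (⊛-comm _ z))

⊖-⊛-ζ^ : ∀ {n} a (z : Vec ℤ n) → ⊖ (z ⊛ ζ^ a) ≡ z ⊛ ζ^ (a + + n)
⊖-⊛-ζ^ {n} a z = begin
  ⊖ (z ⊛ ζ^ a)                ≡⟨ cong ⊖_ (sym (⊛-identityʳ (z ⊛ ζ^ a))) ⟩
  ⊖ ((z ⊛ ζ^ a) ⊛ 1c)         ≡⟨ sym (⊛-⊖ (z ⊛ ζ^ a) 1c) ⟩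
  (z ⊛ ζ^ a) ⊛ ⊖ 1c           ≡⟨ cong ((z ⊛ ζ^ a) ⊛_) (sym ζ^-half) ⟩
  (z ⊛ ζ^ a) ⊛ ζ^ (+ n)       ≡⟨ ⊛-assoc z (ζ^ a) (ζ^ (+ n)) ⟩
  z ⊛ (ζ^ a ⊛ ζ^ (+ n))       ≡⟨ cong (z ⊛_) (sym (ζ^-+ a (+ n))) ⟩
  z ⊛ ζ^ (a + + n)            ∎
  where open ≡-Reasoning

ζ^-⊛-⊕ : ∀ {n} a c (z₁ z₂ : Vec ℤ n) → ζ^ a ⊛ (z₁ ⊕ ζ^ c ⊛ z₂) ≡ z₁ ⊛ ζ^ a ⊕ z₂ ⊛ ζ^ (a + c)
ζ^-⊛-⊕ a c z₁ z₂ = trans (⊛-distribˡ (ζ^ a) z₁ _) (cong₂ _⊕_ (⊛-comm (ζ^ a) z₁) (ζ^-⊛-ζ^ a c z₂))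

ζ^-⊛-⊖ : ∀ {n} b c (z₃ z₄ : Vec ℤ n) → ζ^ b ⊛ (z₃ ⊕ ⊖ (ζ^ c ⊛ z₄)) ≡ z₃ ⊛ ζ^ b ⊕ z₄ ⊛ ζ^ (b + c + + n)
ζ^-⊛-⊖ b c z₃ z₄ = trans (⊛-distribˡ (ζ^ b) z₃ _)
  (cong₂ _⊕_ (⊛-comm (ζ^ b) z₃) (trans (⊛-⊖ (ζ^ b) _) (trans (cong ⊖_ (ζ^-⊛-ζ^ b c z₄)) (⊖-⊛-ζ^ (b + c) z₄))))

module EvenExponent (b : ℕ) (χ : ℤ → Cyc ((suc (suc (suc b)) ℕ.+ 0) ℕ.+ suc (suc (suc b)))) (u : ℤ)
  (induced : InducedFrom (2 ^ ((suc (suc (suc b)) ℕ.+ 0) ℕ.+ suc (suc (suc b)))) (2 ^ suc (suc (suc b))) χ)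
  (odd-u : OddZ u) where

  open Collapse b 0 χ u

  w = + 4 * V * V

  Ew≡4V² : E * w ≡ + 4 * V * V
  Ew≡4V² = ℤP.*-identityˡ w

  c = + (2 ^ (α ∸ 2)) * u

  block[1] : block (1 ℕ.+ x ℕ.* 0) ≡ (+ M) · (χ (+ 1) ⊛ ζ^ (+ 2 * u))
  block[1] = trans (block⁺ induced odd-u w Ew≡4V² 0) (cong₂ (λ a z → (+ M) · (a ⊛ z)) χ≡ ζ≡)
    where
    χ≡ : χ (+ (1 ℕ.+ x ℕ.* 0)) ≡ χ (+ 1)
    χ≡ = cong (λ m → χ (+ (1 ℕ.+ m))) (ℕP.*-zeroʳ x)
    reduce : ∀ u V → u * (+ 2 * + 1 + + 1 * (+ 4 * V * + 0) * (+ 4 * V * + 0) - + 4 * V * + 0 * (+ 4 * V * + 0) * (+ 4 * V * + 0)) ≡ + 2 * u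
    reduce = solve-∀
    ζ≡ : ζ^ (blockExponent V u (+ 1) (+ 0)) ≡ ζ^ (+ 2 * u)
    ζ≡ = cong ζ^ (reduce u V)

  block[1+x] : block (1 ℕ.+ x ℕ.* 1) ≡ (+ M) · (χ (+ 1 + + x) ⊛ ζ^ (+ 2 * u + c))
  block[1+x] = trans (block⁺ induced odd-u w Ew≡4V² 1) (cong₂ (λ a z → (+ M) · (a ⊛ z)) χ≡ ζ≡)
    where
    χ≡ : χ (+ (1 ℕ.+ x ℕ.* 1)) ≡ χ (+ 1 + + x)
    χ≡ = cong (λ m → χ (+ (1 ℕ.+ m))) (ℕP.*-identityʳ x)
    reduce : ∀ u V → u * (+ 2 * + 1 + + 1 * (+ 4 * V * + 1) * (+ 4 * V * + 1) - + 4 * V * + 1 * (+ 4 * V * + 1) * (+ 4 * V * + 1)) ≡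
                     (+ 2 * u + + 16 * V * V * + 1 * u) + + 64 * V * V * + 1 * - (V * u)
    reduce = solve-∀
    ζ≡ : ζ^ (blockExponent V u (+ 1) (+ 1)) ≡ ζ^ (+ 2 * u + c)
    ζ≡ = trans (ζ^-mod (+ 2 * u + + 16 * V * V * E * u) (- (V * u)) (reduce u V)) (cong (λ z → ζ^ (+ 2 * u + z * u)) (sym 2^[α∸2]≡16V²E))

  block[x-1] : block (x ∸ 1 ℕ.+ x ℕ.* 0) ≡ (+ M) · (χ (- + 1 + + x) ⊛ ζ^ (- (+ 2 * u) + c + + n))
  block[x-1] = trans (block⁻ induced odd-u w Ew≡4V² 0) (cong₂ (λ a z → (+ M) · (a ⊛ z)) χ≡ ζ≡)
    where
    χ≡ : χ (+ (x ∸ 1 ℕ.+ x ℕ.* 0)) ≡ χ (- + 1 + + x)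
    χ≡ = cong χ (trans (x-1+xj≡-1+Y 0) (cong (λ z → - + 1 + z) (trans (ℤP.*-identityʳ (+ 4 * V)) (sym x≡4V))))
    reduce : ∀ u k V → u ≡ + 1 + + 2 * k →
             u * (+ 2 * - + 1 + - + 1 * (+ 4 * V * (+ 1 + + 0)) * (+ 4 * V * (+ 1 + + 0)) - + 4 * V * (+ 1 + + 0) * (+ 4 * V * (+ 1 + + 0)) * (+ 4 * V * (+ 1 + + 0))) ≡
             (- (+ 2 * u) + + 16 * V * V * + 1 * u + + 32 * V * V * + 1) + + 64 * V * V * + 1 * (- (+ 1 + k) - V * u)
    reduce u k V refl = expand k V
      where
      expand : ∀ k V →
               (+ 1 + + 2 * k) * (+ 2 * - + 1 + - + 1 * (+ 4 * V * (+ 1 + + 0)) * (+ 4 * V * (+ 1 + + 0)) - + 4 * V * (+ 1 + + 0) * (+ 4 * V * (+ 1 + + 0)) * (+ 4 * V * (+ 1 + + 0))) ≡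
               (- (+ 2 * (+ 1 + + 2 * k)) + + 16 * V * V * + 1 * (+ 1 + + 2 * k) + + 32 * V * V * + 1) + + 64 * V * V * + 1 * (- (+ 1 + k) - V * (+ 1 + + 2 * k))
      expand = solve-∀
    ζ≡ : ζ^ (blockExponent V u (- + 1) (+ 1 + + 0)) ≡ ζ^ (- (+ 2 * u) + c + + n)
    ζ≡ = trans (ζ^-mod (- (+ 2 * u) + + 16 * V * V * E * u + + 32 * V * V * E) (- (+ 1 + proj₁ odd-u) - V * u) (reduce u (proj₁ odd-u) V (proj₂ odd-u)))
               (cong₂ (λ i h → ζ^ (- (+ 2 * u) + i * u + h)) (sym 2^[α∸2]≡16V²E) (sym n≡32V²E))

  block[2x-1] : block (x ∸ 1 ℕ.+ x ℕ.* 1) ≡ (+ M) · (χ (- + 1) ⊛ ζ^ (- (+ 2 * u)))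
  block[2x-1] = trans (block⁻ induced odd-u w Ew≡4V² 1) (cong₂ (λ a z → (+ M) · (a ⊛ z)) χ≡ ζ≡)
    where
    double : ∀ V → + 4 * V * (+ 1 + + 1) ≡ + 8 * V * + 1
    double = solve-∀
    χ≡ : χ (+ (x ∸ 1 ℕ.+ x ℕ.* 1)) ≡ χ (- + 1)
    χ≡ = trans (cong χ (trans (x-1+xj≡-1+Y 1) (cong (λ z → - + 1 + z) (trans (double V) (cong (_* + 1) (sym M≡8V))))))
               (induced-periodic-odd {α = α} {m = suc (suc b)} induced (- + 1) 1 (±1-odd (inj₂ refl)))
    reduce : ∀ u V → u * (+ 2 * - + 1 + - + 1 * (+ 4 * V * (+ 1 + + 1)) * (+ 4 * V * (+ 1 + + 1)) - + 4 * V * (+ 1 + + 1) * (+ 4 * V * (+ 1 + + 1)) * (+ 4 * V * (+ 1 + + 1))) ≡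
                     - (+ 2 * u) + + 64 * V * V * + 1 * (- u - + 8 * V * u)
    reduce = solve-∀
    ζ≡ : ζ^ (blockExponent V u (- + 1) (+ 1 + + 1)) ≡ ζ^ (- (+ 2 * u))
    ζ≡ = ζ^-mod (- (+ 2 * u)) (- u - + 8 * V * u) (reduce u V)

  RHS-expand : ζ^ (+ 2 * u) ⊛ (χ (+ 1) ⊕ ζ^ c ⊛ χ (+ 1 + + x)) ⊕ ζ^ (- (+ 2 * u)) ⊛ (χ (- + 1) ⊕ ⊖ (ζ^ c ⊛ χ (- + 1 + + x))) ≡
               (χ (+ 1) ⊛ ζ^ (+ 2 * u) ⊕ χ (+ 1 + + x) ⊛ ζ^ (+ 2 * u + c))
                 ⊕ (χ (- + 1) ⊛ ζ^ (- (+ 2 * u)) ⊕ χ (- + 1 + + x) ⊛ ζ^ (- (+ 2 * u) + c + + n))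
  RHS-expand = cong₂ _⊕_ (ζ^-⊛-⊕ (+ 2 * u) c _ _) (ζ^-⊛-⊖ (- (+ 2 * u)) c _ _)

  theorem : S α χ u u ≡
              (+ M) · ( ωC α u ⊛ (χ (+ 1) ⊕ (iC α ^ᶻ u) ⊛ χ (+ 1 + + x))
                      ⊕ conj (ωC α u) ⊛ (χ (- + 1) ⊕ ⊖ ((iC α ^ᶻ u) ⊛ χ (- + 1 + + x))))
  theorem = begin
    S α χ u u
      ≡⟨ S-collapse induced odd-u ⟩
    (0c ⊕ block (1 ℕ.+ x ℕ.* 0)) ⊕ block (1 ℕ.+ x ℕ.* 1) ⊕ ((0c ⊕ block (x ∸ 1 ℕ.+ x ℕ.* 0)) ⊕ block (x ∸ 1 ℕ.+ x ℕ.* 1))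
      ≡⟨ cong₂ _⊕_ (cong₂ _⊕_ (trans (⊕-identityˡ _) block[1]) block[1+x]) (cong₂ _⊕_ (trans (⊕-identityˡ _) block[x-1]) block[2x-1]) ⟩
    ((+ M) · P₁ ⊕ (+ M) · P₂) ⊕ ((+ M) · Q₁ ⊕ (+ M) · Q₂)
      ≡⟨ cong₂ _⊕_ (sym (·-distribˡ-⊕ (+ M) P₁ P₂)) (trans (⊕-comm _ _) (sym (·-distribˡ-⊕ (+ M) Q₂ Q₁))) ⟩
    (+ M) · (P₁ ⊕ P₂) ⊕ (+ M) · (Q₂ ⊕ Q₁)
      ≡⟨ sym (·-distribˡ-⊕ (+ M) _ _) ⟩
    (+ M) · ((P₁ ⊕ P₂) ⊕ (Q₂ ⊕ Q₁))
      ≡⟨ cong ((+ M) ·_) (sym RHS-expand) ⟩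
    (+ M) · (ζ^ (+ 2 * u) ⊛ (χ (+ 1) ⊕ ζ^ c ⊛ χ (+ 1 + + x)) ⊕ ζ^ (- (+ 2 * u)) ⊛ (χ (- + 1) ⊕ ⊖ (ζ^ c ⊛ χ (- + 1 + + x))))
      ≡⟨ sym (cong₂ (λ iᵘ ω̄ → (+ M) · (ζ^ (+ 2 * u) ⊛ (χ (+ 1) ⊕ iᵘ ⊛ χ (+ 1 + + x)) ⊕ ω̄ ⊛ (χ (- + 1) ⊕ ⊖ (iᵘ ⊛ χ (- + 1 + + x)))))
                    (ζ^-^ᶻ (+ (2 ^ (α ∸ 2))) u) (conj-ζ^ (+ 2 * u))) ⟩
    (+ M) · ( ωC α u ⊛ (χ (+ 1) ⊕ (iC α ^ᶻ u) ⊛ χ (+ 1 + + x))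
            ⊕ conj (ωC α u) ⊛ (χ (- + 1) ⊕ ⊖ ((iC α ^ᶻ u) ⊛ χ (- + 1 + + x)))) ∎
    where
    open ≡-Reasoning
    P₁ = χ (+ 1) ⊛ ζ^ (+ 2 * u)
    P₂ = χ (+ 1 + + x) ⊛ ζ^ (+ 2 * u + c)
    Q₁ = χ (- + 1 + + x) ⊛ ζ^ (- (+ 2 * u) + c + + n)
    Q₂ = χ (- + 1) ⊛ ζ^ (- (+ 2 * u))

-- The case α = 2β + 1

oddBlockExponent : ℤ → ℤ → ℤ → ℤ → ℤ
oddBlockExponent V u ε t = + 2 * ε * u + + 16 * V * V * (+ 1 + ε) * u + + 16 * V * V * (u * t)

-- The common value modulo 128V² depends on whether V = 1 (β = 3) or V is even: this is where t = tC β comes from.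
blockExponent-odd-J : ∀ b u ε J → J ≡ + 1 ⊎ J ≡ + 3 → Σ ℤ λ r →
                      blockExponent (+ (2 ^ b)) u ε J ≡ oddBlockExponent (+ (2 ^ b)) u ε (tC (3 ℕ.+ b)) + + 128 * + (2 ^ b) * + (2 ^ b) * r
blockExponent-odd-J zero    u ε J (inj₁ refl) = - u , reduce u ε
  where
  reduce : ∀ u ε → u * (+ 2 * ε + ε * (+ 4 * + 1 * + 1) * (+ 4 * + 1 * + 1) - + 4 * + 1 * + 1 * (+ 4 * + 1 * + 1) * (+ 4 * + 1 * + 1)) ≡
                   (+ 2 * ε * u + + 16 * + 1 * + 1 * (+ 1 + ε) * u + + 16 * + 1 * + 1 * (u * + 3)) + + 128 * + 1 * + 1 * - u
  reduce = solve-∀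
blockExponent-odd-J zero    u ε J (inj₂ refl) = u * (ε - + 14) , reduce u ε
  where
  reduce : ∀ u ε → u * (+ 2 * ε + ε * (+ 4 * + 1 * + 3) * (+ 4 * + 1 * + 3) - + 4 * + 1 * + 3 * (+ 4 * + 1 * + 3) * (+ 4 * + 1 * + 3)) ≡
                   (+ 2 * ε * u + + 16 * + 1 * + 1 * (+ 1 + ε) * u + + 16 * + 1 * + 1 * (u * + 3)) + + 128 * + 1 * + 1 * (u * (ε - + 14))
  reduce = solve-∀
blockExponent-odd-J (suc b) u ε J (inj₁ refl) = - (W * u) ,
  subst (λ V → blockExponent V u ε (+ 1) ≡ oddBlockExponent V u ε (- + 1) + + 128 * V * V * - (W * u)) (sym (ℤP.pos-* 2 (2 ^ b))) (reduce u ε W)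
  where
  W = + (2 ^ b)
  reduce : ∀ u ε W → u * (+ 2 * ε + ε * (+ 4 * (+ 2 * W) * + 1) * (+ 4 * (+ 2 * W) * + 1) - + 4 * (+ 2 * W) * + 1 * (+ 4 * (+ 2 * W) * + 1) * (+ 4 * (+ 2 * W) * + 1)) ≡
                     (+ 2 * ε * u + + 16 * (+ 2 * W) * (+ 2 * W) * (+ 1 + ε) * u + + 16 * (+ 2 * W) * (+ 2 * W) * (u * - + 1)) + + 128 * (+ 2 * W) * (+ 2 * W) * - (W * u)
  reduce = solve-∀
blockExponent-odd-J (suc b) u ε J (inj₂ refl) = ε * u - + 27 * W * u ,
  subst (λ V → blockExponent V u ε (+ 3) ≡ oddBlockExponent V u ε (- + 1) + + 128 * V * V * (ε * u - + 27 * W * u)) (sym (ℤP.pos-* 2 (2 ^ b))) (reduce u ε W)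
  where
  W = + (2 ^ b)
  reduce : ∀ u ε W → u * (+ 2 * ε + ε * (+ 4 * (+ 2 * W) * + 3) * (+ 4 * (+ 2 * W) * + 3) - + 4 * (+ 2 * W) * + 3 * (+ 4 * (+ 2 * W) * + 3) * (+ 4 * (+ 2 * W) * + 3)) ≡
                     (+ 2 * ε * u + + 16 * (+ 2 * W) * (+ 2 * W) * (+ 1 + ε) * u + + 16 * (+ 2 * W) * (+ 2 * W) * (u * - + 1)) + + 128 * (+ 2 * W) * (+ 2 * W) * (ε * u - + 27 * W * u)
  reduce = solve-∀

sC≡tC+2 : ∀ b → sC (3 ℕ.+ b) ≡ tC (3 ℕ.+ b) + + 2
sC≡tC+2 zero    = refl
sC≡tC+2 (suc b) = refl

sumTo-4-cancel₀₂ : ∀ {n} (f : ℕ → Vec ℤ n) → f 0 ⊕ f 2 ≡ 0c → sumTo 4 f ≡ f 1 ⊕ f 3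
sumTo-4-cancel₀₂ f f₀+f₂≡0 = cong (_⊕ f 3) (begin
  ((0c ⊕ f 0) ⊕ f 1) ⊕ f 2  ≡⟨ cong (λ z → (z ⊕ f 1) ⊕ f 2) (⊕-identityˡ (f 0)) ⟩
  (f 0 ⊕ f 1) ⊕ f 2         ≡⟨ ⊕-assoc (f 0) (f 1) (f 2) ⟩
  f 0 ⊕ (f 1 ⊕ f 2)         ≡⟨ cong (f 0 ⊕_) (⊕-comm (f 1) (f 2)) ⟩
  f 0 ⊕ (f 2 ⊕ f 1)         ≡⟨ sym (⊕-assoc (f 0) (f 2) (f 1)) ⟩
  (f 0 ⊕ f 2) ⊕ f 1         ≡⟨ cong (_⊕ f 1) f₀+f₂≡0 ⟩
  0c ⊕ f 1                  ≡⟨ ⊕-identityˡ (f 1) ⟩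
  f 1                       ∎)
  where open ≡-Reasoning

sumTo-4-cancel₁₃ : ∀ {n} (f : ℕ → Vec ℤ n) → f 1 ⊕ f 3 ≡ 0c → sumTo 4 f ≡ f 0 ⊕ f 2
sumTo-4-cancel₁₃ f f₁+f₃≡0 = begin
  (((0c ⊕ f 0) ⊕ f 1) ⊕ f 2) ⊕ f 3   ≡⟨ ⊕-assoc _ (f 2) (f 3) ⟩
  ((0c ⊕ f 0) ⊕ f 1) ⊕ (f 2 ⊕ f 3)   ≡⟨ cong (((0c ⊕ f 0) ⊕ f 1) ⊕_) (⊕-comm (f 2) (f 3)) ⟩
  ((0c ⊕ f 0) ⊕ f 1) ⊕ (f 3 ⊕ f 2)   ≡⟨ sym (⊕-assoc _ (f 3) (f 2)) ⟩
  (((0c ⊕ f 0) ⊕ f 1) ⊕ f 3) ⊕ f 2   ≡⟨ cong (_⊕ f 2) (⊕-assoc (0c ⊕ f 0) (f 1) (f 3)) ⟩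
  ((0c ⊕ f 0) ⊕ (f 1 ⊕ f 3)) ⊕ f 2   ≡⟨ cong (λ z → ((0c ⊕ f 0) ⊕ z) ⊕ f 2) f₁+f₃≡0 ⟩
  ((0c ⊕ f 0) ⊕ 0c) ⊕ f 2            ≡⟨ cong (_⊕ f 2) (trans (⊕-identityʳ _) (⊕-identityˡ (f 0))) ⟩
  f 0 ⊕ f 2                          ∎
  where open ≡-Reasoning

·-⊛-⊖-cancel : ∀ {n} c (z y : Vec ℤ n) → c · (z ⊛ y) ⊕ c · (z ⊛ ⊖ y) ≡ 0c
·-⊛-⊖-cancel c z y = begin
  c · (z ⊛ y) ⊕ c · (z ⊛ ⊖ y)   ≡⟨ sym (·-distribˡ-⊕ c _ _) ⟩
  c · (z ⊛ y ⊕ z ⊛ ⊖ y)         ≡⟨ cong (λ v → c · (z ⊛ y ⊕ v)) (⊛-⊖ z y) ⟩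
  c · (z ⊛ y ⊕ ⊖ (z ⊛ y))       ≡⟨ cong (c ·_) (⊕-inverseʳ _) ⟩
  c · 0c                        ≡⟨ ·-zeroʳ c ⟩
  0c                            ∎
  where open ≡-Reasoning

·-double-ζ^ : ∀ {n} (a p r : ℤ) (z : Vec ℤ n) → (+ 2) · (ζ^ a ⊛ ζ^ p ⊛ ζ^ r ⊛ z) ≡ z ⊛ ζ^ (a + p + r) ⊕ z ⊛ ζ^ (a + p + r)
·-double-ζ^ a p r z = trans (·-double _) (cong₂ _⊕_ merge merge)
  where
  merge : ζ^ a ⊛ ζ^ p ⊛ ζ^ r ⊛ z ≡ z ⊛ ζ^ (a + p + r)
  merge = trans (cong (λ y → y ⊛ ζ^ r ⊛ z) (sym (ζ^-+ a p))) (trans (cong (_⊛ z) (sym (ζ^-+ (a + p) r))) (⊛-comm _ z))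

ζ^-⊛-⊛-⊕ : ∀ {n} (b r p′ r′ : ℤ) (z : Vec ℤ n) → ζ^ b ⊛ z ⊛ (ζ^ r ⊕ ζ^ p′ ⊛ ζ^ r′) ≡ z ⊛ ζ^ (b + r) ⊕ z ⊛ ζ^ (b + (p′ + r′))
ζ^-⊛-⊛-⊕ b r p′ r′ z = begin
  ζ^ b ⊛ z ⊛ (ζ^ r ⊕ ζ^ p′ ⊛ ζ^ r′)          ≡⟨ cong (_⊛ (ζ^ r ⊕ ζ^ p′ ⊛ ζ^ r′)) (⊛-comm (ζ^ b) z) ⟩
  z ⊛ ζ^ b ⊛ (ζ^ r ⊕ ζ^ p′ ⊛ ζ^ r′)          ≡⟨ ⊛-assoc z (ζ^ b) _ ⟩
  z ⊛ (ζ^ b ⊛ (ζ^ r ⊕ ζ^ p′ ⊛ ζ^ r′))        ≡⟨ cong (z ⊛_) (⊛-distribˡ (ζ^ b) (ζ^ r) _) ⟩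
  z ⊛ (ζ^ b ⊛ ζ^ r ⊕ ζ^ b ⊛ (ζ^ p′ ⊛ ζ^ r′)) ≡⟨ ⊛-distribˡ z _ _ ⟩
  z ⊛ (ζ^ b ⊛ ζ^ r) ⊕ z ⊛ (ζ^ b ⊛ (ζ^ p′ ⊛ ζ^ r′))
    ≡⟨ cong₂ (λ y y′ → z ⊛ y ⊕ z ⊛ y′) (sym (ζ^-+ b r)) (trans (cong (ζ^ b ⊛_) (sym (ζ^-+ p′ r′))) (sym (ζ^-+ b (p′ + r′)))) ⟩
  z ⊛ ζ^ (b + r) ⊕ z ⊛ ζ^ (b + (p′ + r′))    ∎
  where open ≡-Reasoning

module OddExponent (b : ℕ) (χ : ℤ → Cyc ((suc (suc (suc b)) ℕ.+ 1) ℕ.+ suc (suc (suc b)))) (u : ℤ)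
  (induced : InducedFrom (2 ^ ((suc (suc (suc b)) ℕ.+ 1) ℕ.+ suc (suc (suc b)))) (2 ^ suc (suc (suc b))) χ)
  (odd-u : OddZ u) where

  open Collapse b 1 χ u

  w = + 2 * V * V

  Ew≡4V² : E * w ≡ + 4 * V * V
  Ew≡4V² = regroup V
    where
    regroup : ∀ V → + 2 * (+ 2 * V * V) ≡ + 4 * V * V
    regroup = solve-∀

  k = proj₁ odd-u
  t = tC β
  A⁺ = oddBlockExponent V u (+ 1) t
  A⁻ = oddBlockExponent V u (- + 1) t

  ζ^-mod-128 : ∀ {a} c r → a ≡ c + + 128 * V * V * r → ζ^ {n} a ≡ ζ^ c
  ζ^-mod-128 c r a≡c+128V²r = ζ^-mod c r (trans a≡c+128V²r (cong (λ N → c + N * r) (regroup V)))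
    where
    regroup : ∀ V → + 128 * V * V ≡ + 64 * V * V * + 2
    regroup = solve-∀

  ζ^-mod-half : ∀ {a} c r → a ≡ c + + 64 * V * V + + 128 * V * V * r → ζ^ {n} a ≡ ⊖ ζ^ c
  ζ^-mod-half c r a≡c+n+128V²r = trans (ζ^-mod-128 (c + + n) r (trans a≡c+n+128V²r (cong (λ m → c + m + + 128 * V * V * r) (sym n≡64V²))))
                                       (ζ^-+n c)
    where
    n≡64V² : + n ≡ + 64 * V * V
    n≡64V² = trans n≡32V²E (regroup V)
      where
      regroup : ∀ V → + 32 * V * V * + 2 ≡ + 64 * V * V
      regroup = solve-∀

  ζ^-A : ∀ ε J → J ≡ + 1 ⊎ J ≡ + 3 → ζ^ {n} (blockExponent V u ε J) ≡ ζ^ (oddBlockExponent V u ε t)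
  ζ^-A ε J J≡1,3 = ζ^-mod-128 (oddBlockExponent V u ε t) (proj₁ witness) (proj₂ witness)
    where witness = blockExponent-odd-J b u ε J J≡1,3

  χ-shift : ∀ a h m → OddZ a → + h ≡ a + + M * + m → χ (+ h) ≡ χ a
  χ-shift a h m odd-a h≡a+Mm = trans (cong χ h≡a+Mm) (induced-periodic-odd {α = α} {m = suc (suc b)} induced a m odd-a)

  odd-ε+x : ∀ ε → ε ≡ + 1 ⊎ ε ≡ - + 1 → OddZ (ε + + x)
  odd-ε+x ε ε≡±1 = subst OddZ (cong (λ z → ε + z) (trans (sym (ℤP.*-assoc (+ 2) (+ 2) V)) (sym x≡4V))) (odd-+-even (+ 2 * V) (±1-odd ε≡±1))

  block[1] : block (1 ℕ.+ x ℕ.* 0) ≡ (+ M) · (χ (+ 1) ⊛ ζ^ (+ 2 * u))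
  block[1] = trans (block⁺ induced odd-u w Ew≡4V² 0) (cong₂ (λ a z → (+ M) · (a ⊛ z)) χ≡ ζ≡)
    where
    χ≡ : χ (+ (1 ℕ.+ x ℕ.* 0)) ≡ χ (+ 1)
    χ≡ = cong (λ m → χ (+ (1 ℕ.+ m))) (ℕP.*-zeroʳ x)
    reduce : ∀ u V → u * (+ 2 * + 1 + + 1 * (+ 4 * V * + 0) * (+ 4 * V * + 0) - + 4 * V * + 0 * (+ 4 * V * + 0) * (+ 4 * V * + 0)) ≡ + 2 * u
    reduce = solve-∀
    ζ≡ : ζ^ (blockExponent V u (+ 1) (+ 0)) ≡ ζ^ (+ 2 * u)
    ζ≡ = cong ζ^ (reduce u V)

  block[1+x] : block (1 ℕ.+ x ℕ.* 1) ≡ (+ M) · (χ (+ 1 + + x) ⊛ ζ^ A⁺)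
  block[1+x] = trans (block⁺ induced odd-u w Ew≡4V² 1) (cong₂ (λ a z → (+ M) · (a ⊛ z)) χ≡ (ζ^-A (+ 1) (+ 1) (inj₁ refl)))
    where
    χ≡ : χ (+ (1 ℕ.+ x ℕ.* 1)) ≡ χ (+ 1 + + x)
    χ≡ = cong (λ m → χ (+ (1 ℕ.+ m))) (ℕP.*-identityʳ x)

  block[1+2x] : block (1 ℕ.+ x ℕ.* 2) ≡ (+ M) · (χ (+ 1) ⊛ ⊖ ζ^ (+ 2 * u))
  block[1+2x] = trans (block⁺ induced odd-u w Ew≡4V² 2) (cong₂ (λ a z → (+ M) · (a ⊛ z)) χ≡ ζ≡)
    where
    double : ∀ V → + 4 * V * + 2 ≡ + 8 * V * + 1
    double = solve-∀
    χ≡ : χ (+ (1 ℕ.+ x ℕ.* 2)) ≡ χ (+ 1)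
    χ≡ = χ-shift (+ 1) _ 1 (±1-odd (inj₁ refl)) (trans (1+xj≡1+Y 2) (cong (λ m → + 1 + m) (trans (double V) (cong (_* + 1) (sym M≡8V)))))
    reduce : ∀ u k V → u ≡ + 1 + + 2 * k →
             u * (+ 2 * + 1 + + 1 * (+ 4 * V * + 2) * (+ 4 * V * + 2) - + 4 * V * + 2 * (+ 4 * V * + 2) * (+ 4 * V * + 2)) ≡
             + 2 * u + + 64 * V * V + + 128 * V * V * (k - + 4 * V * u)
    reduce u k V refl = expand k V
      where
      expand : ∀ k V → (+ 1 + + 2 * k) * (+ 2 * + 1 + + 1 * (+ 4 * V * + 2) * (+ 4 * V * + 2) - + 4 * V * + 2 * (+ 4 * V * + 2) * (+ 4 * V * + 2)) ≡
                       + 2 * (+ 1 + + 2 * k) + + 64 * V * V + + 128 * V * V * (k - + 4 * V * (+ 1 + + 2 * k))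
      expand = solve-∀
    ζ≡ : ζ^ (blockExponent V u (+ 1) (+ 2)) ≡ ⊖ ζ^ (+ 2 * u)
    ζ≡ = ζ^-mod-half (+ 2 * u) (k - + 4 * V * u) (reduce u k V (proj₂ odd-u))

  block[1+3x] : block (1 ℕ.+ x ℕ.* 3) ≡ (+ M) · (χ (+ 1 + + x) ⊛ ζ^ A⁺)
  block[1+3x] = trans (block⁺ induced odd-u w Ew≡4V² 3) (cong₂ (λ a z → (+ M) · (a ⊛ z)) χ≡ (ζ^-A (+ 1) (+ 3) (inj₂ refl)))
    where
    regroup : ∀ V → + 1 + + 4 * V * + 3 ≡ + 1 + + 4 * V + + 8 * V * + 1
    regroup = solve-∀
    χ≡ : χ (+ (1 ℕ.+ x ℕ.* 3)) ≡ χ (+ 1 + + x)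
    χ≡ = χ-shift (+ 1 + + x) _ 1 (odd-ε+x (+ 1) (inj₁ refl))
           (trans (1+xj≡1+Y 3) (trans (regroup V) (cong₂ (λ a m → + 1 + a + m * + 1) (sym x≡4V) (sym M≡8V))))

  block[x-1] : block (x ∸ 1 ℕ.+ x ℕ.* 0) ≡ (+ M) · (χ (- + 1 + + x) ⊛ ζ^ A⁻)
  block[x-1] = trans (block⁻ induced odd-u w Ew≡4V² 0) (cong₂ (λ a z → (+ M) · (a ⊛ z)) χ≡ (ζ^-A (- + 1) (+ 1) (inj₁ refl)))
    where
    χ≡ : χ (+ (x ∸ 1 ℕ.+ x ℕ.* 0)) ≡ χ (- + 1 + + x)
    χ≡ = cong χ (trans (x-1+xj≡-1+Y 0) (cong (λ z → - + 1 + z) (trans (ℤP.*-identityʳ (+ 4 * V)) (sym x≡4V))))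

  block[2x-1] : block (x ∸ 1 ℕ.+ x ℕ.* 1) ≡ (+ M) · (χ (- + 1) ⊛ ⊖ ζ^ (- (+ 2 * u)))
  block[2x-1] = trans (block⁻ induced odd-u w Ew≡4V² 1) (cong₂ (λ a z → (+ M) · (a ⊛ z)) χ≡ ζ≡)
    where
    double : ∀ V → + 4 * V * (+ 1 + + 1) ≡ + 8 * V * + 1
    double = solve-∀
    χ≡ : χ (+ (x ∸ 1 ℕ.+ x ℕ.* 1)) ≡ χ (- + 1)
    χ≡ = χ-shift (- + 1) _ 1 (±1-odd (inj₂ refl)) (trans (x-1+xj≡-1+Y 1) (cong (λ z → - + 1 + z) (trans (double V) (cong (_* + 1) (sym M≡8V)))))
    reduce : ∀ u k V → u ≡ + 1 + + 2 * k →
             u * (+ 2 * - + 1 + - + 1 * (+ 4 * V * (+ 1 + + 1)) * (+ 4 * V * (+ 1 + + 1)) - + 4 * V * (+ 1 + + 1) * (+ 4 * V * (+ 1 + + 1)) * (+ 4 * V * (+ 1 + + 1))) ≡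
             - (+ 2 * u) + + 64 * V * V + + 128 * V * V * (- (+ 1 + k) - + 4 * V * u)
    reduce u k V refl = expand k V
      where
      expand : ∀ k V →
               (+ 1 + + 2 * k) * (+ 2 * - + 1 + - + 1 * (+ 4 * V * (+ 1 + + 1)) * (+ 4 * V * (+ 1 + + 1)) - + 4 * V * (+ 1 + + 1) * (+ 4 * V * (+ 1 + + 1)) * (+ 4 * V * (+ 1 + + 1))) ≡
               - (+ 2 * (+ 1 + + 2 * k)) + + 64 * V * V + + 128 * V * V * (- (+ 1 + k) - + 4 * V * (+ 1 + + 2 * k))
      expand = solve-∀
    ζ≡ : ζ^ (blockExponent V u (- + 1) (+ 1 + + 1)) ≡ ⊖ ζ^ (- (+ 2 * u))
    ζ≡ = ζ^-mod-half (- (+ 2 * u)) (- (+ 1 + k) - + 4 * V * u) (reduce u k V (proj₂ odd-u))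

  block[3x-1] : block (x ∸ 1 ℕ.+ x ℕ.* 2) ≡ (+ M) · (χ (- + 1 + + x) ⊛ ζ^ A⁻)
  block[3x-1] = trans (block⁻ induced odd-u w Ew≡4V² 2) (cong₂ (λ a z → (+ M) · (a ⊛ z)) χ≡ (ζ^-A (- + 1) (+ 3) (inj₂ refl)))
    where
    regroup : ∀ V → - + 1 + + 4 * V * (+ 1 + + 2) ≡ - + 1 + + 4 * V + + 8 * V * + 1
    regroup = solve-∀
    χ≡ : χ (+ (x ∸ 1 ℕ.+ x ℕ.* 2)) ≡ χ (- + 1 + + x)
    χ≡ = χ-shift (- + 1 + + x) _ 1 (odd-ε+x (- + 1) (inj₂ refl))
           (trans (x-1+xj≡-1+Y 2) (trans (regroup V) (cong₂ (λ a m → - + 1 + a + m * + 1) (sym x≡4V) (sym M≡8V))))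

  block[4x-1] : block (x ∸ 1 ℕ.+ x ℕ.* 3) ≡ (+ M) · (χ (- + 1) ⊛ ζ^ (- (+ 2 * u)))
  block[4x-1] = trans (block⁻ induced odd-u w Ew≡4V² 3) (cong₂ (λ a z → (+ M) · (a ⊛ z)) χ≡ ζ≡)
    where
    double : ∀ V → + 4 * V * (+ 1 + + 3) ≡ + 8 * V * + 2
    double = solve-∀
    χ≡ : χ (+ (x ∸ 1 ℕ.+ x ℕ.* 3)) ≡ χ (- + 1)
    χ≡ = χ-shift (- + 1) _ 2 (±1-odd (inj₂ refl)) (trans (x-1+xj≡-1+Y 3) (cong (λ z → - + 1 + z) (trans (double V) (cong (_* + 2) (sym M≡8V)))))
    reduce : ∀ u V → u * (+ 2 * - + 1 + - + 1 * (+ 4 * V * (+ 1 + + 3)) * (+ 4 * V * (+ 1 + + 3)) - + 4 * V * (+ 1 + + 3) * (+ 4 * V * (+ 1 + + 3)) * (+ 4 * V * (+ 1 + + 3))) ≡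
                     - (+ 2 * u) + + 128 * V * V * (- (+ 2 * u) - + 32 * V * u)
    reduce = solve-∀
    ζ≡ : ζ^ (blockExponent V u (- + 1) (+ 1 + + 3)) ≡ ζ^ (- (+ 2 * u))
    ζ≡ = ζ^-mod-128 (- (+ 2 * u)) (- (+ 2 * u) - + 32 * V * u) (reduce u V)

  classSum-1≡ : classSum 1 ≡ (+ M) · (χ (+ 1 + + x) ⊛ ζ^ A⁺) ⊕ (+ M) · (χ (+ 1 + + x) ⊛ ζ^ A⁺)
  classSum-1≡ = trans (sumTo-4-cancel₀₂ (λ j → block (1 ℕ.+ x ℕ.* j)) cancel) (cong₂ _⊕_ block[1+x] block[1+3x])
    where
    cancel : block (1 ℕ.+ x ℕ.* 0) ⊕ block (1 ℕ.+ x ℕ.* 2) ≡ 0c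
    cancel = trans (cong₂ _⊕_ block[1] block[1+2x]) (·-⊛-⊖-cancel (+ M) (χ (+ 1)) (ζ^ (+ 2 * u)))

  classSum-[x-1]≡ : classSum (x ∸ 1) ≡ (+ M) · (χ (- + 1 + + x) ⊛ ζ^ A⁻) ⊕ (+ M) · (χ (- + 1 + + x) ⊛ ζ^ A⁻)
  classSum-[x-1]≡ = trans (sumTo-4-cancel₁₃ (λ j → block (x ∸ 1 ℕ.+ x ℕ.* j)) cancel) (cong₂ _⊕_ block[x-1] block[3x-1])
    where
    cancel : block (x ∸ 1 ℕ.+ x ℕ.* 1) ⊕ block (x ∸ 1 ℕ.+ x ℕ.* 3) ≡ 0c
    cancel = trans (⊕-comm _ _) (trans (cong₂ _⊕_ block[4x-1] block[2x-1]) (·-⊛-⊖-cancel (+ M) (χ (- + 1)) (ζ^ (- (+ 2 * u)))))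

  I = + (2 ^ (α ∸ 2))
  R = + (2 ^ (α ∸ 3))

  RHS-expand : (+ 2) · (ζ^ (+ 2 * u) ⊛ ζ^ (I * u) ⊛ ζ^ (R * (u * t)) ⊛ χ (+ 1 + + x))
                 ⊕ ζ^ (- (+ 2 * u)) ⊛ χ (- + 1 + + x) ⊛ (ζ^ (R * (u * t)) ⊕ ζ^ (I * - u) ⊛ ζ^ (R * (u * sC β))) ≡
               (χ (+ 1 + + x) ⊛ ζ^ A⁺ ⊕ χ (+ 1 + + x) ⊛ ζ^ A⁺) ⊕ (χ (- + 1 + + x) ⊛ ζ^ A⁻ ⊕ χ (- + 1 + + x) ⊛ ζ^ A⁻)
  RHS-expand = cong₂ _⊕_
    (trans (·-double-ζ^ (+ 2 * u) (I * u) (R * (u * t)) (χ (+ 1 + + x)))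
           (cong (λ a → χ (+ 1 + + x) ⊛ ζ^ a ⊕ χ (+ 1 + + x) ⊛ ζ^ a) exponent⁺))
    (trans (ζ^-⊛-⊛-⊕ (- (+ 2 * u)) (R * (u * t)) (I * - u) (R * (u * sC β)) (χ (- + 1 + + x)))
           (cong₂ (λ a a′ → χ (- + 1 + + x) ⊛ ζ^ a ⊕ χ (- + 1 + + x) ⊛ ζ^ a′) exponent⁻ exponent⁻′))
    where
    exponent⁺ : + 2 * u + I * u + R * (u * t) ≡ A⁺
    exponent⁺ = trans (cong₂ (λ i r → + 2 * u + i * u + r * (u * t)) 2^[α∸2]≡16V²E 2^[α∸3]≡8V²E) (regroup u V t)
      where
      regroup : ∀ u V t → + 2 * u + + 16 * V * V * + 2 * u + + 8 * V * V * + 2 * (u * t) ≡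
                          + 2 * + 1 * u + + 16 * V * V * (+ 1 + + 1) * u + + 16 * V * V * (u * t)
      regroup = solve-∀
    exponent⁻ : - (+ 2 * u) + R * (u * t) ≡ A⁻
    exponent⁻ = trans (cong (λ r → - (+ 2 * u) + r * (u * t)) 2^[α∸3]≡8V²E) (regroup u V t)
      where
      regroup : ∀ u V t → - (+ 2 * u) + + 8 * V * V * + 2 * (u * t) ≡ + 2 * - + 1 * u + + 16 * V * V * (+ 1 + - + 1) * u + + 16 * V * V * (u * t)
      regroup = solve-∀
    exponent⁻′ : - (+ 2 * u) + (I * - u + R * (u * sC β)) ≡ A⁻
    exponent⁻′ = trans (cong₃ 2^[α∸2]≡16V²E 2^[α∸3]≡8V²E (sC≡tC+2 b)) (regroup u V t)
      where
      cong₃ : ∀ {i i′ r r′ s s′} → i ≡ i′ → r ≡ r′ → s ≡ s′ → - (+ 2 * u) + (i * - u + r * (u * s)) ≡ - (+ 2 * u) + (i′ * - u + r′ * (u * s′))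
      cong₃ refl refl refl = refl
      regroup : ∀ u V t → - (+ 2 * u) + (+ 16 * V * V * + 2 * - u + + 8 * V * V * + 2 * (u * (t + + 2))) ≡
                          + 2 * - + 1 * u + + 16 * V * V * (+ 1 + - + 1) * u + + 16 * V * V * (u * t)
      regroup = solve-∀

  theorem : S α χ u u ≡
              (+ M) · ( (+ 2) · (ωC α u ⊛ (iC α ^ᶻ u) ⊛ (sqrtiC α ^ᶻ (u * t)) ⊛ χ (+ 1 + + x))
                      ⊕ conj (ωC α u) ⊛ χ (- + 1 + + x)
                          ⊛ ((sqrtiC α ^ᶻ (u * t)) ⊕ (iC α ^ᶻ (- u)) ⊛ (sqrtiC α ^ᶻ (u * sC β))))
  theorem = begin
    S α χ u u
      ≡⟨ S-collapse induced odd-u ⟩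
    classSum 1 ⊕ classSum (x ∸ 1)
      ≡⟨ cong₂ _⊕_ classSum-1≡ classSum-[x-1]≡ ⟩
    ((+ M) · P ⊕ (+ M) · P) ⊕ ((+ M) · Q ⊕ (+ M) · Q)
      ≡⟨ sym (trans (·-distribˡ-⊕ (+ M) (P ⊕ P) (Q ⊕ Q)) (cong₂ _⊕_ (·-distribˡ-⊕ (+ M) P P) (·-distribˡ-⊕ (+ M) Q Q))) ⟩
    (+ M) · ((P ⊕ P) ⊕ (Q ⊕ Q))
      ≡⟨ cong ((+ M) ·_) (sym RHS-expand) ⟩
    (+ M) · ( (+ 2) · (ζ^ (+ 2 * u) ⊛ ζ^ (I * u) ⊛ ζ^ (R * (u * t)) ⊛ χ (+ 1 + + x))
            ⊕ ζ^ (- (+ 2 * u)) ⊛ χ (- + 1 + + x) ⊛ (ζ^ (R * (u * t)) ⊕ ζ^ (I * - u) ⊛ ζ^ (R * (u * sC β))))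
      ≡⟨ sym (powers (conj-ζ^ (+ 2 * u)) (ζ^-^ᶻ I u) (ζ^-^ᶻ R (u * t)) (ζ^-^ᶻ I (- u)) (ζ^-^ᶻ R (u * sC β))) ⟩
    (+ M) · ( (+ 2) · (ωC α u ⊛ (iC α ^ᶻ u) ⊛ (sqrtiC α ^ᶻ (u * t)) ⊛ χ (+ 1 + + x))
            ⊕ conj (ωC α u) ⊛ χ (- + 1 + + x)
                ⊛ ((sqrtiC α ^ᶻ (u * t)) ⊕ (iC α ^ᶻ (- u)) ⊛ (sqrtiC α ^ᶻ (u * sC β)))) ∎
    where
    open ≡-Reasoning
    P = χ (+ 1 + + x) ⊛ ζ^ A⁺
    Q = χ (- + 1 + + x) ⊛ ζ^ A⁻
    powers : ∀ {ω̄ ω̄′ iᵘ iᵘ′ rᵘᵗ rᵘᵗ′ i⁻ᵘ i⁻ᵘ′ rᵘˢ rᵘˢ′} → ω̄ ≡ ω̄′ → iᵘ ≡ iᵘ′ → rᵘᵗ ≡ rᵘᵗ′ → i⁻ᵘ ≡ i⁻ᵘ′ → rᵘˢ ≡ rᵘˢ′ →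
             (+ M) · ((+ 2) · (ζ^ (+ 2 * u) ⊛ iᵘ ⊛ rᵘᵗ ⊛ χ (+ 1 + + x)) ⊕ ω̄ ⊛ χ (- + 1 + + x) ⊛ (rᵘᵗ ⊕ i⁻ᵘ ⊛ rᵘˢ)) ≡
             (+ M) · ((+ 2) · (ζ^ (+ 2 * u) ⊛ iᵘ′ ⊛ rᵘᵗ′ ⊛ χ (+ 1 + + x)) ⊕ ω̄′ ⊛ χ (- + 1 + + x) ⊛ (rᵘᵗ′ ⊕ i⁻ᵘ′ ⊛ rᵘˢ′))
    powers refl refl refl refl refl = refl

2*β≡[β+0]+β : ∀ β → 2 ℕ.* β ≡ (β ℕ.+ 0) ℕ.+ β
2*β≡[β+0]+β = ℕ-Solver.solve-∀

2*β+1≡[β+1]+β : ∀ β → 2 ℕ.* β ℕ.+ 1 ≡ (β ℕ.+ 1) ℕ.+ β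
2*β+1≡[β+1]+β = ℕ-Solver.solve-∀

S-even-exponent : ∀ b α → α ≡ 2 ℕ.* (3 ℕ.+ b) →
  (χ : ℤ → Cyc α) → IsDirichletChar (2 ^ α) χ → InducedFrom (2 ^ α) (2 ^ (3 ℕ.+ b)) χ → (u : ℤ) → OddZ u →
  S α χ u u ≡
    (+ (2 ^ (3 ℕ.+ b))) · ( ωC α u ⊛ (χ (+ 1) ⊕ (iC α ^ᶻ u) ⊛ χ (+ 1 + + (2 ^ (2 ℕ.+ b))))
                          ⊕ conj (ωC α u) ⊛ (χ (- + 1) ⊕ ⊖ ((iC α ^ᶻ u) ⊛ χ (- + 1 + + (2 ^ (2 ℕ.+ b))))))
S-even-exponent b α α≡2β rewrite trans α≡2β (2*β≡[β+0]+β (3 ℕ.+ b)) =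
  λ χ _ induced u odd-u → EvenExponent.theorem b χ u induced odd-u

S-odd-exponent : ∀ b α → α ≡ 2 ℕ.* (3 ℕ.+ b) ℕ.+ 1 →
  (χ : ℤ → Cyc α) → IsDirichletChar (2 ^ α) χ → InducedFrom (2 ^ α) (2 ^ (3 ℕ.+ b)) χ → (u : ℤ) → OddZ u →
  S α χ u u ≡
    (+ (2 ^ (3 ℕ.+ b))) · ( (+ 2) · (ωC α u ⊛ (iC α ^ᶻ u) ⊛ (sqrtiC α ^ᶻ (u * tC (3 ℕ.+ b))) ⊛ χ (+ 1 + + (2 ^ (2 ℕ.+ b))))
                          ⊕ conj (ωC α u) ⊛ χ (- + 1 + + (2 ^ (2 ℕ.+ b)))
                              ⊛ ((sqrtiC α ^ᶻ (u * tC (3 ℕ.+ b))) ⊕ (iC α ^ᶻ (- u)) ⊛ (sqrtiC α ^ᶻ (u * sC (3 ℕ.+ b)))))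
S-odd-exponent b α α≡2β+1 rewrite trans α≡2β+1 (2*β+1≡[β+1]+β (3 ℕ.+ b)) =
  λ χ _ induced u odd-u → OddExponent.theorem b χ u induced odd-u

proposition3p12 :
    (β : ℕ) → 3 ≤ β →
    ((α : ℕ) → α ≡ 2 Data.Nat.* β →
      (χ : ℤ → Cyc α) → IsDirichletChar (2 ^ α) χ → InducedFrom (2 ^ α) (2 ^ β) χ →
      (u : ℤ) → OddZ u →
      S α χ u u ≡
        (+ (2 ^ β)) · ( ωC α u ⊛ (χ (+ 1) ⊕ (iC α ^ᶻ u) ⊛ χ (+ 1 + + (2 ^ (β ∸ 1))))
                      ⊕ conj (ωC α u) ⊛ (χ (- + 1) ⊕ ⊖ ((iC α ^ᶻ u) ⊛ χ (- + 1 + + (2 ^ (β ∸ 1)))))))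
    ×
    ((α : ℕ) → α ≡ 2 Data.Nat.* β Data.Nat.+ 1 →
      (χ : ℤ → Cyc α) → IsDirichletChar (2 ^ α) χ → InducedFrom (2 ^ α) (2 ^ β) χ →
      (u : ℤ) → OddZ u →
      S α χ u u ≡
        (+ (2 ^ β)) · ( (+ 2) · (ωC α u ⊛ (iC α ^ᶻ u) ⊛ (sqrtiC α ^ᶻ (u * tC β)) ⊛ χ (+ 1 + + (2 ^ (β ∸ 1))))
                      ⊕ conj (ωC α u) ⊛ χ (- + 1 + + (2 ^ (β ∸ 1)))
                          ⊛ ((sqrtiC α ^ᶻ (u * tC β)) ⊕ (iC α ^ᶻ (- u)) ⊛ (sqrtiC α ^ᶻ (u * sC β)))))
proposition3p12 (suc (suc (suc b))) (s≤s (s≤s (s≤s z≤n))) = S-even-exponent b , S-odd-exponent b
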